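{- Let $A$ be an abelian group of order $v\equiv 2$ or $4\pmod 6$, let $h_0\in A$ be a fixed element of order $2$, and let $\omega_1=|\{a\in A:2a=0\}|$, $\omega_2=|\{a\in A:4a=0\}|$. Then $$|\mathcal B_0|=\frac18 v^2\omega_1-\frac1{24}v(2\omega_1^2+3\omega_2-2).$$
   Context: For a finite abelian group $A$ (additive), $\hat A$ is the permutation group on $A$ generated by translations $x\mapsto x+a$ and $x\mapsto -x$; the $\hat A$-orbit of $X$ is $\{X+c\}_{c\in A}\cup\{ -X+c\}_{c\in A}$, and $[a_1,\dots,a_t]$ denotes the $\hat A$-orbit of $\{0,a_1,\dots,a_t\}$. $\Omega_1(A)=\{a: 2a=0\}$. $\mathcal Q_1=\{[a,-a,h_0]: a\in A\setminus\Omega_1(A)\}$, $\mathcal Q_2=\{[a,h,h+a]: a\in A\setminus\Omega_1(A),\ h\in\Omega_1(A)\setminus\{0,h_0\},\ 2a\ne h\}$, $\mathcal Q_3=\{[h,h',h+h']: h,h'\in\Omega_1(A)\setminus\{0\},\ h\ne h'\}$; $\mathcal B_0$ is the set of $4$-subsets of $A$ whose $\hat A$-orbit lies in $\mathcal Q_1\cup\mathcal Q_2\cup\mathcal Q_3$. -}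

module Defs where

open import Data.Nat using (ℕ)
open import Data.Bool using (Bool; _∨_)
open import Data.Fin using (Fin)
open import Data.Fin.Properties using (_≟_)
open import Data.Fin.Subset using (Subset; ∣_∣)
open import Data.Vec using (tabulate)
open import Data.List using (List; length; filter; allFin)
open import Data.List.Relation.Unary.Unique.Propositional using (Unique)
open import Data.List.Membership.Propositional using (_∈_)
open import Data.Product using (Σ; ∃; ∃-syntax; _×_)
open import Data.Sum using (_⊎_)
open import Relation.Nullary using (¬_; ⌊_⌋)
open import Relation.Binary.PropositionalEquality using (_≡_; _≢_)
open import Function.Bundles using (_⇔_)
open import Algebra.Structures using (IsAbelianGroup)

-- A finite abelian group of order v, with carrier Fin v (every finite
-- abelian group of order v is isomorphic to one of this form).
record FinAbGroup (v : ℕ) : Set where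
  infixl 6 _+_
  field
    _+_ : Fin v → Fin v → Fin v
    0#  : Fin v
    -_  : Fin v → Fin v
    isAbelianGroup : IsAbelianGroup _≡_ _+_ 0# -_

module _ {v : ℕ} (G : FinAbGroup v) where
  open FinAbGroup G

  ω₁ : ℕ
  ω₁ = length (filter (λ a → (a + a) ≟ 0#) (allFin v))

  ω₂ : ℕ
  ω₂ = length (filter (λ a → (a + a + a + a) ≟ 0#) (allFin v))

  set4 : Fin v → Fin v → Fin v → Fin v → Subset v
  set4 p q r s = tabulate (λ x → ⌊ x ≟ p ⌋ ∨ ⌊ x ≟ q ⌋ ∨ ⌊ x ≟ r ⌋ ∨ ⌊ x ≟ s ⌋)

  -- X lies in the Â-orbit [a₁,a₂,a₃] of {0,a₁,a₂,a₃}, i.e.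
  -- X = {0,a₁,a₂,a₃} + c  or  X = -{0,a₁,a₂,a₃} + c  for some c ∈ A.
  InOrbit : Subset v → Fin v → Fin v → Fin v → Set
  InOrbit X a₁ a₂ a₃ = ∃[ c ]
      (X ≡ set4 c (a₁ + c) (a₂ + c) (a₃ + c)
     ⊎ X ≡ set4 c (- a₁ + c) (- a₂ + c) (- a₃ + c))

  Ω₁ : Fin v → Set
  Ω₁ a = a + a ≡ 0#

  module _ (h₀ : Fin v) where
    InQ₁ : Subset v → Set
    InQ₁ X = ∃[ a ] (¬ Ω₁ a × InOrbit X a (- a) h₀)

    InQ₂ : Subset v → Set
    InQ₂ X = ∃[ a ] ∃[ h ] (¬ Ω₁ a × Ω₁ h × h ≢ 0# × h ≢ h₀ × a + a ≢ h
                            × InOrbit X a h (h + a))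

    InQ₃ : Subset v → Set
    InQ₃ X = ∃[ h ] ∃[ h' ] (Ω₁ h × Ω₁ h' × h ≢ 0# × h' ≢ 0# × h ≢ h'
                             × InOrbit X h h' (h + h'))

    InB₀ : Subset v → Set
    InB₀ X = ∣ X ∣ ≡ 4 × (InQ₁ X ⊎ InQ₂ X ⊎ InQ₃ X)

    EnumeratesB₀ : List (Subset v) → Set
    EnumeratesB₀ L = Unique L × (∀ X → (X ∈ L) ⇔ InB₀ X)

module Submission where

-- ℬ₀ is the disjoint union of four families of translates c + D: the sets c + {0, a, -a, h₀}
-- with 2a ∉ {0, h₀}; the cosets of the cyclic groups {0, a, -a, h₀} with 2a = h₀; the sets
-- c + {0, a, h, h + a} of 𝒬₂; and the cosets of the Klein groups {0, h, k, h + k} of 𝒬₃.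
-- Each family is counted by double counting its parameter tuples (c, …): every set has
-- exactly 4, 8, 8, resp. 24 representations.  The admissible parameters are counted via
-- the numbers of solutions of 2a = h, and the number of solutions of 2a = h₀ cancels.

open import Defs

open import Algebra.Structures using (IsAbelianGroup)
open import Data.Empty using (⊥-elim)
open import Data.Fin.Base using (Fin; zero; suc)
open import Data.Fin.Properties using (_≟_)
open import Data.Fin.Subset using (Subset; _∈_; _⊆_; ∣_∣)
open import Data.Fin.Subset.Properties using (_∈?_)
open import Data.Nat.Base using (ℕ)
open import Data.Product.Base using (Σ; _×_; _,_; proj₁; proj₂)
open import Data.Sum.Base using (_⊎_; inj₁; inj₂)
open import Function.Base using (_∘_)
open import Relation.Binary.PropositionalEquality
open import Relation.Nullary.Decidable using (Dec; yes; no; _×-dec_; _⊎-dec_; ¬?)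
open import Relation.Nullary.Negation using (¬_)

module Counting where

  open import Data.Bool.Base using (true; false)
  open import Level using (Level)
  import Data.Fin.Properties as Fin
  open import Data.List.Base using (List; []; _∷_; _++_; map; filter; length; tabulate)
  open import Data.Nat.Base using (zero; suc; _+_; _*_)
  open import Data.Nat.Properties using (+-*-semiring; +-commutativeSemigroup; +-assoc; +-identityʳ; *-identityʳ; *-distribʳ-+)
  open import Algebra.Properties.CommutativeSemigroup +-commutativeSemigroup using (interchange)
  open import Relation.Nullary.Decidable using (_because_)
  open import Relation.Unary using (Pred; Decidable)
  open import Algebra.Properties.Semiring.Sum +-*-semiring public
    using (sum; sum-syntax; sum-cong-≗; ∑-distrib-+; ∑-comm; ∑-permute; *-distribˡ-sum; *-distribʳ-sum; sum-replicate-zero)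

  private
    variable
      ℓ ℓ′ : Level
      P : Set ℓ
      Q : Set ℓ′

  𝟙 : Dec P → ℕ
  𝟙 (true  because _) = 1
  𝟙 (false because _) = 0

  𝟙-no : (P? : Dec P) → ¬ P → 𝟙 P? ≡ 0
  𝟙-no (yes p) ¬p = ⊥-elim (¬p p)
  𝟙-no (no _)  _  = refl

  𝟙-cong : (P? : Dec P) (Q? : Dec Q) → (P → Q) → (Q → P) → 𝟙 P? ≡ 𝟙 Q?
  𝟙-cong (yes _) (yes _) _   _   = refl
  𝟙-cong (yes p) (no ¬q) p→q _   = ⊥-elim (¬q (p→q p))
  𝟙-cong (no ¬p) (yes q) _   q→p = ⊥-elim (¬p (q→p q))
  𝟙-cong (no _)  (no _)  _   _   = refl

  𝟙-× : (P? : Dec P) (Q? : Dec Q) → 𝟙 (P? ×-dec Q?) ≡ 𝟙 P? * 𝟙 Q?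
  𝟙-× (yes _) (yes _) = refl
  𝟙-× (yes _) (no _)  = refl
  𝟙-× (no _)  (yes _) = refl
  𝟙-× (no _)  (no _)  = refl

  𝟙-⊎ : (P? : Dec P) (Q? : Dec Q) → ¬ (P × Q) → 𝟙 (P? ⊎-dec Q?) ≡ 𝟙 P? + 𝟙 Q?
  𝟙-⊎ (yes p) (yes q) ¬p×q = ⊥-elim (¬p×q (p , q))
  𝟙-⊎ (yes _) (no _)  _    = refl
  𝟙-⊎ (no _)  (yes _) _    = refl
  𝟙-⊎ (no _)  (no _)  _    = refl

  count : ∀ {n} {P : Pred (Fin n) ℓ} → Decidable P → ℕ
  count {n = n} P? = ∑[ i < n ] 𝟙 (P? i)

  ∑-const : ∀ n k → ∑[ i < n ] k ≡ n * k
  ∑-const zero    k = refl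
  ∑-const (suc n) k = cong (k +_) (∑-const n k)

  ∑-𝟙≡* : ∀ {n} (j : Fin n) (f : Fin n → ℕ) → ∑[ i < n ] (𝟙 (i Fin.≟ j) * f i) ≡ f j
  ∑-𝟙≡* {suc n} zero f = begin
    f zero + 0 + ∑[ i < n ] (𝟙 (suc i Fin.≟ zero) * f (suc i))  ≡⟨ cong₂ _+_ (+-identityʳ (f zero)) (sum-cong-≗ (λ i → cong (_* f (suc i)) (𝟙-no (suc i Fin.≟ zero) λ ()))) ⟩
    f zero + ∑[ i < n ] 0                                       ≡⟨ cong (f zero +_) (sum-replicate-zero n) ⟩
    f zero + 0                                                  ≡⟨ +-identityʳ (f zero) ⟩
    f zero                                                      ∎
    where open ≡-Reasoning
  ∑-𝟙≡* {suc n} (suc j) f = cong (0 +_) (trans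
    (sum-cong-≗ (λ i → cong (_* f (suc i)) (𝟙-cong (suc i Fin.≟ suc j) (i Fin.≟ j) Fin.suc-injective (cong suc))))
    (∑-𝟙≡* j (f ∘ suc)))

  ∑-𝟙≡ : ∀ {n} (j : Fin n) → ∑[ i < n ] 𝟙 (i Fin.≟ j) ≡ 1
  ∑-𝟙≡ {n} j = trans (sum-cong-≗ (λ i → sym (*-identityʳ (𝟙 (i Fin.≟ j))))) (∑-𝟙≡* j (λ _ → 1))

  count-pair : ∀ {n} {i j : Fin n} → i ≢ j → count (λ k → k Fin.≟ i ⊎-dec k Fin.≟ j) ≡ 2
  count-pair {n} {i} {j} i≢j = begin
    count (λ k → k Fin.≟ i ⊎-dec k Fin.≟ j)                     ≡⟨ sum-cong-≗ (λ k → 𝟙-⊎ (k Fin.≟ i) (k Fin.≟ j) (λ (k≡i , k≡j) → i≢j (trans (sym k≡i) k≡j))) ⟩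
    ∑[ k < n ] (𝟙 (k Fin.≟ i) + 𝟙 (k Fin.≟ j))                  ≡⟨ ∑-distrib-+ (λ k → 𝟙 (k Fin.≟ i)) (λ k → 𝟙 (k Fin.≟ j)) ⟩
    ∑[ k < n ] 𝟙 (k Fin.≟ i) + ∑[ k < n ] 𝟙 (k Fin.≟ j)          ≡⟨ cong₂ _+_ (∑-𝟙≡ i) (∑-𝟙≡ j) ⟩
    2                                                            ∎
    where open ≡-Reasoning

  module _ {n} {P : Pred (Fin n) ℓ} (P? : Decidable P) where

    ∑-𝟙*-remove : ∀ {j} → P j → (f : Fin n → ℕ) →
                  ∑[ i < n ] (𝟙 (P? i ×-dec ¬? (i Fin.≟ j)) * f i) + f j ≡ ∑[ i < n ] (𝟙 (P? i) * f i)
    ∑-𝟙*-remove {j} Pj f = begin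
      ∑[ i < n ] (𝟙 (P? i ×-dec ¬? (i Fin.≟ j)) * f i) + f j                                  ≡⟨ cong (∑[ i < n ] (𝟙 (P? i ×-dec ¬? (i Fin.≟ j)) * f i) +_) (∑-𝟙≡* j f) ⟨
      ∑[ i < n ] (𝟙 (P? i ×-dec ¬? (i Fin.≟ j)) * f i) + ∑[ i < n ] (𝟙 (i Fin.≟ j) * f i)     ≡⟨ ∑-distrib-+ (λ i → 𝟙 (P? i ×-dec ¬? (i Fin.≟ j)) * f i) _ ⟨
      ∑[ i < n ] (𝟙 (P? i ×-dec ¬? (i Fin.≟ j)) * f i + 𝟙 (i Fin.≟ j) * f i)                 ≡⟨ sum-cong-≗ {n} (λ i → trans (sym (*-distribʳ-+ (f i) (𝟙 (P? i ×-dec ¬? (i Fin.≟ j))) (𝟙 (i Fin.≟ j)))) (cong (_* f i) (split i))) ⟩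
      ∑[ i < n ] (𝟙 (P? i) * f i)                                                            ∎
      where
      open ≡-Reasoning
      split : ∀ i → 𝟙 (P? i ×-dec ¬? (i Fin.≟ j)) + 𝟙 (i Fin.≟ j) ≡ 𝟙 (P? i)
      split i with P? i | i Fin.≟ j
      ... | yes _  | yes _    = refl
      ... | yes _  | no _     = refl
      ... | no ¬Pi | yes refl = ⊥-elim (¬Pi Pj)
      ... | no _   | no _     = refl

    count-remove : ∀ {j} → P j → count (λ i → P? i ×-dec ¬? (i Fin.≟ j)) + 1 ≡ count P?
    count-remove {j} Pj = begin
      count (λ i → P? i ×-dec ¬? (i Fin.≟ j)) + 1                 ≡⟨ cong (_+ 1) (sum-cong-≗ {n} (λ i → sym (*-identityʳ (𝟙 (P? i ×-dec ¬? (i Fin.≟ j)))))) ⟩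
      ∑[ i < n ] (𝟙 (P? i ×-dec ¬? (i Fin.≟ j)) * 1) + 1          ≡⟨ ∑-𝟙*-remove Pj (λ _ → 1) ⟩
      ∑[ i < n ] (𝟙 (P? i) * 1)                                   ≡⟨ sum-cong-≗ {n} (λ i → *-identityʳ (𝟙 (P? i))) ⟩
      count P?                                                    ∎
      where open ≡-Reasoning

    ∑-𝟙*-const : ∀ (f : Fin n → ℕ) m → (∀ i → P i → f i ≡ m) → ∑[ i < n ] (𝟙 (P? i) * f i) ≡ count P? * m
    ∑-𝟙*-const f m f≡m = trans (sum-cong-≗ on-P) (sym (*-distribʳ-sum m (λ i → 𝟙 (P? i))))
      where
      on-P : ∀ i → 𝟙 (P? i) * f i ≡ 𝟙 (P? i) * m
      on-P i with P? i
      ... | yes Pi = cong (_+ 0) (f≡m i Pi)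
      ... | no _   = refl

  ∑ˡ : ∀ {a} {A : Set a} → List A → (A → ℕ) → ℕ
  ∑ˡ []       f = 0
  ∑ˡ (x ∷ xs) f = f x + ∑ˡ xs f

  module _ {a} {A : Set a} where

    ∑ˡ-cong : ∀ (xs : List A) {f g : A → ℕ} → (∀ x → f x ≡ g x) → ∑ˡ xs f ≡ ∑ˡ xs g
    ∑ˡ-cong []       f≗g = refl
    ∑ˡ-cong (x ∷ xs) f≗g = cong₂ _+_ (f≗g x) (∑ˡ-cong xs f≗g)

    ∑ˡ-++ : ∀ (xs ys : List A) f → ∑ˡ (xs ++ ys) f ≡ ∑ˡ xs f + ∑ˡ ys f
    ∑ˡ-++ []       ys f = refl
    ∑ˡ-++ (x ∷ xs) ys f = trans (cong (f x +_) (∑ˡ-++ xs ys f)) (sym (+-assoc (f x) _ _))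

    ∑ˡ-map : ∀ {b} {B : Set b} (g : B → A) (xs : List B) f → ∑ˡ (map g xs) f ≡ ∑ˡ xs (f ∘ g)
    ∑ˡ-map g []       f = refl
    ∑ˡ-map g (x ∷ xs) f = cong (f (g x) +_) (∑ˡ-map g xs f)

    ∑ˡ-0 : ∀ (xs : List A) → ∑ˡ xs (λ _ → 0) ≡ 0
    ∑ˡ-0 []       = refl
    ∑ˡ-0 (_ ∷ xs) = ∑ˡ-0 xs

    ∑ˡ-distrib-+ : ∀ (xs : List A) (f g : A → ℕ) → ∑ˡ xs (λ x → f x + g x) ≡ ∑ˡ xs f + ∑ˡ xs g
    ∑ˡ-distrib-+ []       f g = refl
    ∑ˡ-distrib-+ (x ∷ xs) f g = trans (cong (f x + g x +_) (∑ˡ-distrib-+ xs f g)) (interchange (f x) (g x) _ _)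

    ∑ˡ-*ʳ : ∀ (xs : List A) k (f : A → ℕ) → ∑ˡ xs (λ x → f x * k) ≡ ∑ˡ xs f * k
    ∑ˡ-*ʳ []       k f = refl
    ∑ˡ-*ʳ (x ∷ xs) k f = trans (cong (f x * k +_) (∑ˡ-*ʳ xs k f)) (sym (*-distribʳ-+ k (f x) _))

    ∑ˡ-∑-comm : ∀ (xs : List A) n (g : A → Fin n → ℕ) → ∑ˡ xs (λ x → ∑[ i < n ] g x i) ≡ ∑[ i < n ] ∑ˡ xs (λ x → g x i)
    ∑ˡ-∑-comm []       n g = sym (sum-replicate-zero n)
    ∑ˡ-∑-comm (x ∷ xs) n g = trans (cong (∑[ i < n ] g x i +_) (∑ˡ-∑-comm xs n g)) (sym (∑-distrib-+ (g x) _))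

    length-filter : ∀ {P : Pred A ℓ} (P? : Decidable P) (xs : List A) →
                    length (filter P? xs) ≡ ∑ˡ xs (λ x → 𝟙 (P? x))
    length-filter P? []       = refl
    length-filter P? (x ∷ xs) with P? x
    ... | yes _ = cong suc (length-filter P? xs)
    ... | no _  = length-filter P? xs

  ∑ˡ-tabulate : ∀ {a} {A : Set a} n (g : Fin n → A) f → ∑ˡ (tabulate g) f ≡ ∑[ i < n ] f (g i)
  ∑ˡ-tabulate zero    g f = refl
  ∑ˡ-tabulate (suc n) g f = cong (f (g zero) +_) (∑ˡ-tabulate n (g ∘ suc) f)

  module _ {n a b} {A : Pred (Fin n) a} {B : Fin n → Pred (Fin n) b}
           (A? : Decidable A) (B? : ∀ i → Decidable (B i)) where

    ∑∑-𝟙× : ∀ m → (∀ i → A i → count (B? i) ≡ m) →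
            ∑[ i < n ] ∑[ j < n ] 𝟙 (A? i ×-dec B? i j) ≡ count A? * m
    ∑∑-𝟙× m count-B = begin
      ∑[ i < n ] ∑[ j < n ] 𝟙 (A? i ×-dec B? i j)     ≡⟨ sum-cong-≗ (λ i → sum-cong-≗ (λ j → 𝟙-× (A? i) (B? i j))) ⟩
      ∑[ i < n ] ∑[ j < n ] (𝟙 (A? i) * 𝟙 (B? i j))   ≡⟨ sum-cong-≗ (λ i → *-distribˡ-sum (𝟙 (A? i)) (λ j → 𝟙 (B? i j))) ⟨
      ∑[ i < n ] (𝟙 (A? i) * count (B? i))            ≡⟨ ∑-𝟙*-const A? (λ i → count (B? i)) m count-B ⟩
      count A? * m                                    ∎
      where open ≡-Reasoning

  module _ {n a b c} {A : Pred (Fin n) a} {B : Fin n → Pred (Fin n) b} {C : Fin n → Fin n → Pred (Fin n) c}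
           (A? : Decidable A) (B? : ∀ i → Decidable (B i)) (C? : ∀ i j → Decidable (C i j)) where

    ∑∑∑-𝟙× : ∀ l m → (∀ i → A i → count (B? i) ≡ l) → (∀ i j → A i → B i j → count (C? i j) ≡ m) →
             ∑[ i < n ] ∑[ j < n ] ∑[ k < n ] 𝟙 (A? i ×-dec (B? i j ×-dec C? i j k)) ≡ count A? * (l * m)
    ∑∑∑-𝟙× l m count-B count-C = begin
      ∑[ i < n ] ∑[ j < n ] ∑[ k < n ] 𝟙 (A? i ×-dec (B? i j ×-dec C? i j k))
        ≡⟨ sum-cong-≗ {n} (λ i → sum-cong-≗ {n} (λ j → trans (sum-cong-≗ {n} (λ k → 𝟙-× (A? i) (B? i j ×-dec C? i j k)))
                                                        (sym (*-distribˡ-sum (𝟙 (A? i)) (λ k → 𝟙 (B? i j ×-dec C? i j k)))))) ⟩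
      ∑[ i < n ] ∑[ j < n ] (𝟙 (A? i) * ∑[ k < n ] 𝟙 (B? i j ×-dec C? i j k))
        ≡⟨ sum-cong-≗ {n} (λ i → *-distribˡ-sum (𝟙 (A? i)) (λ j → ∑[ k < n ] 𝟙 (B? i j ×-dec C? i j k))) ⟨
      ∑[ i < n ] (𝟙 (A? i) * ∑[ j < n ] ∑[ k < n ] 𝟙 (B? i j ×-dec C? i j k))
        ≡⟨ ∑-𝟙*-const A? _ (l * m) (λ i Ai → trans (∑∑-𝟙× (B? i) (C? i) m (λ j → count-C i j Ai)) (cong (_* m) (count-B i Ai))) ⟩
      count A? * (l * m)
        ∎
      where open ≡-Reasoning

open Counting

module FiniteSubsets where

  open import Data.Bool.Base using (true; false)
  import Data.Bool.Properties as Bool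
  open import Data.Fin.Properties using (any?)
  open import Data.Fin.Subset using (inside; outside)
  open import Data.Fin.Subset.Properties using (⊆-antisym; p⊂q⇒∣p∣<∣q∣; drop-there)
  open import Data.List.Base using (List; []; _∷_; _++_; map)
  open import Data.List.Membership.Propositional using () renaming (_∈_ to _∈ˡ_)
  open import Data.List.Membership.Propositional.Properties using (∈-map⁺; ∈-map⁻; ∈-++⁺ˡ; ∈-++⁺ʳ)
  import Data.List.Relation.Unary.All as All
  import Data.List.Relation.Unary.AllPairs as AllPairs
  open import Data.List.Relation.Unary.Any using (here)
  open import Data.List.Relation.Unary.Unique.Propositional using (Unique)
  import Data.List.Relation.Unary.Unique.Propositional.Properties as Unique
  open import Data.Nat.Base using (zero; suc; _+_)
  open import Data.Nat.Properties using (<⇒≢)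
  open import Data.Vec.Base using ([]; _∷_; there)
  open import Data.Vec.Properties using (∷-injective; ≡-dec)
  open import Relation.Nullary.Negation using (contradiction)

  infix 4 _≟ˢ_

  _≟ˢ_ : ∀ {n} (p q : Subset n) → Dec (p ≡ q)
  _≟ˢ_ = ≡-dec Bool._≟_

  ∣p∣≡count∈ : ∀ {n} (p : Subset n) → ∣ p ∣ ≡ count (_∈? p)
  ∣p∣≡count∈ []            = refl
  ∣p∣≡count∈ (inside ∷ p)  = cong suc (∣p∣≡count∈-tail p)
    where
    ∣p∣≡count∈-tail : ∀ {n} (p : Subset n) → ∣ p ∣ ≡ ∑[ i < n ] 𝟙 (suc i ∈? inside ∷ p)
    ∣p∣≡count∈-tail p = trans (∣p∣≡count∈ p) (sum-cong-≗ (λ i → 𝟙-cong (i ∈? p) (suc i ∈? inside ∷ p) there drop-there))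
  ∣p∣≡count∈ (outside ∷ p) = trans (∣p∣≡count∈ p) (sum-cong-≗ (λ i → 𝟙-cong (i ∈? p) (suc i ∈? outside ∷ p) there drop-there))

  ⊆∧∣∣≡⇒≡ : ∀ {n} {p q : Subset n} → p ⊆ q → ∣ p ∣ ≡ ∣ q ∣ → p ≡ q
  ⊆∧∣∣≡⇒≡ {p = p} {q} p⊆q ∣p∣≡∣q∣ with any? (λ x → x ∈? q ×-dec ¬? (x ∈? p))
  ... | yes (x , x∈q , x∉p) = contradiction ∣p∣≡∣q∣ (<⇒≢ (p⊂q⇒∣p∣<∣q∣ (p⊆q , x , x∈q , x∉p)))
  ... | no ∄x = ⊆-antisym p⊆q q⊆p
    where
    q⊆p : q ⊆ p
    q⊆p {x} x∈q with x ∈? p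
    ... | yes x∈p = x∈p
    ... | no x∉p  = ⊥-elim (∄x (x , x∈q , x∉p))

  subsets : ∀ n → List (Subset n)
  subsets zero    = [] ∷ []
  subsets (suc n) = map (inside ∷_) (subsets n) ++ map (outside ∷_) (subsets n)

  ∈-subsets : ∀ {n} (p : Subset n) → p ∈ˡ subsets n
  ∈-subsets []            = here refl
  ∈-subsets (true ∷ p)    = ∈-++⁺ˡ (∈-map⁺ (inside ∷_) (∈-subsets p))
  ∈-subsets {suc n} (false ∷ p) = ∈-++⁺ʳ (map (inside ∷_) (subsets n)) (∈-map⁺ (outside ∷_) (∈-subsets p))

  subsets-unique : ∀ n → Unique (subsets n)
  subsets-unique zero    = All.[] AllPairs.∷ AllPairs.[]
  subsets-unique (suc n) = Unique.++⁺ (Unique.map⁺ (proj₂ ∘ ∷-injective) (subsets-unique n))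
                                      (Unique.map⁺ (proj₂ ∘ ∷-injective) (subsets-unique n)) disjoint
    where
    disjoint : ∀ {r} → ¬ (r ∈ˡ map (inside ∷_) (subsets n) × r ∈ˡ map (outside ∷_) (subsets n))
    disjoint (r∈ , r∈′) with ∈-map⁻ (inside ∷_) r∈ | ∈-map⁻ (outside ∷_) r∈′
    ... | (_ , _ , refl) | (_ , _ , ())

  ∑ˡ-subsets-𝟙≡ : ∀ {n} (p : Subset n) → ∑ˡ (subsets n) (λ q → 𝟙 (p ≟ˢ q)) ≡ 1
  ∑ˡ-subsets-𝟙≡ {zero}  []      = refl
  ∑ˡ-subsets-𝟙≡ {suc n} (b ∷ p) = begin
    ∑ˡ (map (inside ∷_) (subsets n) ++ map (outside ∷_) (subsets n)) (λ q → 𝟙 (b ∷ p ≟ˢ q))   ≡⟨ ∑ˡ-++ (map (inside ∷_) (subsets n)) _ _ ⟩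
    ∑ˡ (map (inside ∷_) (subsets n)) (λ q → 𝟙 (b ∷ p ≟ˢ q))
      + ∑ˡ (map (outside ∷_) (subsets n)) (λ q → 𝟙 (b ∷ p ≟ˢ q))                              ≡⟨ cong₂ _+_ (∑ˡ-map (inside ∷_) (subsets n) _) (∑ˡ-map (outside ∷_) (subsets n) _) ⟩
    ∑ˡ (subsets n) (λ q → 𝟙 (b ∷ p ≟ˢ inside ∷ q)) + ∑ˡ (subsets n) (λ q → 𝟙 (b ∷ p ≟ˢ outside ∷ q)) ≡⟨ by-head b ⟩
    1                                                                                          ∎
    where
    open ≡-Reasoning
    same-head : ∀ b → ∑ˡ (subsets n) (λ q → 𝟙 (b ∷ p ≟ˢ b ∷ q)) ≡ 1
    same-head b = trans (∑ˡ-cong (subsets n) (λ q → 𝟙-cong (b ∷ p ≟ˢ b ∷ q) (p ≟ˢ q) (proj₂ ∘ ∷-injective) (cong (b ∷_))))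
                        (∑ˡ-subsets-𝟙≡ p)
    other-head : ∀ b c → b ≢ c → ∑ˡ (subsets n) (λ q → 𝟙 (b ∷ p ≟ˢ c ∷ q)) ≡ 0
    other-head b c b≢c = trans (∑ˡ-cong (subsets n) (λ q → 𝟙-no (b ∷ p ≟ˢ c ∷ q) (b≢c ∘ proj₁ ∘ ∷-injective)))
                               (∑ˡ-0 (subsets n))
    by-head : ∀ b → ∑ˡ (subsets n) (λ q → 𝟙 (b ∷ p ≟ˢ inside ∷ q)) + ∑ˡ (subsets n) (λ q → 𝟙 (b ∷ p ≟ˢ outside ∷ q)) ≡ 1
    by-head true  = cong₂ _+_ (same-head true) (other-head true false λ ())
    by-head false = cong₂ _+_ (other-head false true λ ()) (same-head false)

open FiniteSubsets

module Summable where

  import Data.Fin.Properties as Fin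
  open import Data.List.Base using (List)
  open import Data.Nat.Base using (_*_)
  open import Data.Nat.Properties using (*-comm; *-identityˡ; +-identityʳ)
  open import Relation.Nullary.Decidable using (map′)

  record SummableType : Set₁ where
    field
      Carrier         : Set
      sumOf           : (Carrier → ℕ) → ℕ
      sumOf-cong      : ∀ {f g : Carrier → ℕ} → (∀ r → f r ≡ g r) → sumOf f ≡ sumOf g
      sumOf-0         : sumOf (λ _ → 0) ≡ 0
      sumOf-∑ˡ-comm   : ∀ {B : Set} (xs : List B) (g : Carrier → B → ℕ) →
                        sumOf (λ r → ∑ˡ xs (g r)) ≡ ∑ˡ xs (λ x → sumOf (λ r → g r x))
      any?            : ∀ {P : Carrier → Set} → (∀ r → Dec (P r)) → Dec (Σ Carrier P)

  finSummable : ℕ → SummableType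
  finSummable n = record
    { Carrier       = Fin n
    ; sumOf         = sum
    ; sumOf-cong    = sum-cong-≗
    ; sumOf-0       = sum-replicate-zero n
    ; sumOf-∑ˡ-comm = λ xs g → sym (∑ˡ-∑-comm xs n (λ x i → g i x))
    ; any?          = Fin.any?
    }

  infixr 2 _×ˢ_

  _×ˢ_ : ℕ → SummableType → SummableType
  n ×ˢ S = record
    { Carrier       = Fin n × Carrier
    ; sumOf         = λ f → ∑[ i < n ] sumOf (λ r → f (i , r))
    ; sumOf-cong    = λ f≗g → sum-cong-≗ (λ i → sumOf-cong (λ r → f≗g (i , r)))
    ; sumOf-0       = trans (sum-cong-≗ {n} (λ _ → sumOf-0)) (sum-replicate-zero n)
    ; sumOf-∑ˡ-comm = λ xs g → trans (sum-cong-≗ (λ i → sumOf-∑ˡ-comm xs (λ r → g (i , r))))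
                                     (sym (∑ˡ-∑-comm xs n (λ x i → sumOf (λ r → g (i , r) x))))
    ; any?          = λ P? → map′ (λ (i , r , p) → (i , r) , p) (λ ((i , r) , p) → i , r , p)
                                  (Fin.any? (λ i → any? (λ r → P? (i , r))))
    }
    where open SummableType S

  module DoubleCounting (S : SummableType) {n : ℕ} where

    open SummableType S

    module _ {V : Carrier → Set} (V? : ∀ r → Dec (V r)) (rep : Carrier → Subset n) where

      Represented : Subset n → Set
      Represented X = Σ Carrier (λ r → V r × X ≡ rep r)

      represented? : ∀ X → Dec (Represented X)
      represented? X = any? (λ r → V? r ×-dec (X ≟ˢ rep r))

      FibreSize : ℕ → Set
      FibreSize k = ∀ r → V r → sumOf (λ r′ → 𝟙 (V? r′ ×-dec (rep r ≟ˢ rep r′))) ≡ k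

      double-count : ∀ k → FibreSize k →
                     sumOf (λ r → 𝟙 (V? r)) ≡ ∑ˡ (subsets n) (λ X → 𝟙 (represented? X)) * k
      double-count k fibre = begin
        sumOf (λ r → 𝟙 (V? r))                                          ≡⟨ sumOf-cong split-by-value ⟩
        sumOf (λ r → ∑ˡ (subsets n) (λ X → 𝟙 (V? r ×-dec (X ≟ˢ rep r)))) ≡⟨ sumOf-∑ˡ-comm (subsets n) _ ⟩
        ∑ˡ (subsets n) (λ X → sumOf (λ r → 𝟙 (V? r ×-dec (X ≟ˢ rep r)))) ≡⟨ ∑ˡ-cong (subsets n) fibre-or-empty ⟩
        ∑ˡ (subsets n) (λ X → 𝟙 (represented? X) * k)                    ≡⟨ ∑ˡ-*ʳ (subsets n) k _ ⟩
        ∑ˡ (subsets n) (λ X → 𝟙 (represented? X)) * k                    ∎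
        where
        open ≡-Reasoning
        split-by-value : ∀ r → 𝟙 (V? r) ≡ ∑ˡ (subsets n) (λ X → 𝟙 (V? r ×-dec (X ≟ˢ rep r)))
        split-by-value r = sym (begin
          ∑ˡ (subsets n) (λ X → 𝟙 (V? r ×-dec (X ≟ˢ rep r)))    ≡⟨ ∑ˡ-cong (subsets n) (λ X → trans (𝟙-× (V? r) (X ≟ˢ rep r))
                                                                     (trans (*-comm (𝟙 (V? r)) _) (cong (_* 𝟙 (V? r)) (𝟙-cong (X ≟ˢ rep r) (rep r ≟ˢ X) sym sym)))) ⟩
          ∑ˡ (subsets n) (λ X → 𝟙 (rep r ≟ˢ X) * 𝟙 (V? r))      ≡⟨ ∑ˡ-*ʳ (subsets n) (𝟙 (V? r)) _ ⟩
          ∑ˡ (subsets n) (λ X → 𝟙 (rep r ≟ˢ X)) * 𝟙 (V? r)      ≡⟨ cong (_* 𝟙 (V? r)) (∑ˡ-subsets-𝟙≡ (rep r)) ⟩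
          1 * 𝟙 (V? r)                                          ≡⟨ *-identityˡ _ ⟩
          𝟙 (V? r)                                              ∎)
        fibre-or-empty : ∀ X → sumOf (λ r → 𝟙 (V? r ×-dec (X ≟ˢ rep r))) ≡ 𝟙 (represented? X) * k
        fibre-or-empty X with represented? X
        ... | yes (r , Vr , refl) = trans (fibre r Vr) (sym (+-identityʳ k))
        ... | no ¬X               = trans (sumOf-cong (λ r → 𝟙-no (V? r ×-dec (X ≟ˢ rep r)) (λ p → ¬X (r , p)))) sumOf-0

open Summable

-- Normalisation to integer coefficient vectors; atoms marked ▶ satisfy
-- x + x ≡ 0#, so their coefficients are reduced mod 2.
module AbelianGroupSolver {v : ℕ} (G : FinAbGroup v) where

  open import Algebra.Bundles using (AbelianGroup)
  open import Level using (0ℓ)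
  import Algebra.Properties.AbelianGroup as AbelianGroupProperties
  import Algebra.Properties.Monoid.Mult as MonoidMultiples
  import Algebra.Properties.CommutativeSemigroup as CommutativeSemigroupProperties
  open import Data.Integer.Base as ℤ using (ℤ; -[1+_]; _⊖_)
  import Data.Integer.Properties as ℤ
  open import Data.Nat.Base as ℕ using (ℕ; zero; suc)
  import Data.Nat.Properties as ℕ
  open import Data.Vec.Base using (Vec; []; _∷_; zipWith; map; replicate)

  open FinAbGroup G
  open IsAbelianGroup isAbelianGroup using (assoc; comm; identityˡ; identityʳ; inverseʳ)

  private
    A : Set
    A = Fin v

    group : AbelianGroup 0ℓ 0ℓ
    group = record { isAbelianGroup = isAbelianGroup }

  open AbelianGroupProperties group using (ε⁻¹≈ε; ⁻¹-involutive; ⁻¹-∙-comm; inverseʳ-unique; x∙y⁻¹≈ε⇒x≈y)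
  open MonoidMultiples (AbelianGroup.monoid group) using (×-homo-+) renaming (_×_ to _·ₙ_)
  open CommutativeSemigroupProperties (AbelianGroup.commutativeSemigroup group) using (interchange)

  neg-+ : ∀ x y → - (x + y) ≡ - x + - y
  neg-+ x y = sym (⁻¹-∙-comm x y)

  infixr 8 _·_

  _·_ : ℤ → A → A
  (ℤ.+ n)  · x = n ·ₙ x
  -[1+ n ] · x = - (suc n ·ₙ x)

  ⊖-· : ∀ m n x → (m ⊖ n) · x ≡ m ·ₙ x + - (n ·ₙ x)
  ⊖-· zero    zero    x = sym (trans (cong (0# +_) ε⁻¹≈ε) (identityˡ 0#))
  ⊖-· zero    (suc n) x = sym (identityˡ _)
  ⊖-· (suc m) zero    x = sym (trans (cong (suc m ·ₙ x +_) ε⁻¹≈ε) (identityʳ _))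
  ⊖-· (suc m) (suc n) x = begin
    (suc m ⊖ suc n) · x                       ≡⟨ cong (_· x) (ℤ.[1+m]⊖[1+n]≡m⊖n m n) ⟩
    (m ⊖ n) · x                               ≡⟨ ⊖-· m n x ⟩
    m ·ₙ x + - (n ·ₙ x)                         ≡⟨ identityˡ _ ⟨
    0# + (m ·ₙ x + - (n ·ₙ x))                  ≡⟨ cong (_+ (m ·ₙ x + - (n ·ₙ x))) (inverseʳ x) ⟨
    (x + - x) + (m ·ₙ x + - (n ·ₙ x))           ≡⟨ interchange x (- x) (m ·ₙ x) (- (n ·ₙ x)) ⟩
    (x + m ·ₙ x) + (- x + - (n ·ₙ x))           ≡⟨ cong (x + m ·ₙ x +_) (neg-+ x (n ·ₙ x)) ⟨
    suc m ·ₙ x + - (suc n ·ₙ x)                 ∎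
    where open ≡-Reasoning

  ·-homo-+ : ∀ i j x → (i ℤ.+ j) · x ≡ i · x + j · x
  ·-homo-+ (ℤ.+ m)    (ℤ.+ n)    x = ×-homo-+ x m n
  ·-homo-+ (ℤ.+ m)    -[1+ n ] x = ⊖-· m (suc n) x
  ·-homo-+ -[1+ m ] (ℤ.+ n)    x = trans (⊖-· n (suc m) x) (comm _ _)
  ·-homo-+ -[1+ m ] -[1+ n ] x = begin
    - (suc (suc (m ℕ.+ n)) ·ₙ x)           ≡⟨ cong (λ k → - (suc k ·ₙ x)) (ℕ.+-suc m n) ⟨
    - ((suc m ℕ.+ suc n) ·ₙ x)             ≡⟨ cong -_ (×-homo-+ x (suc m) (suc n)) ⟩
    - (suc m ·ₙ x + suc n ·ₙ x)             ≡⟨ neg-+ _ _ ⟩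
    - (suc m ·ₙ x) + - (suc n ·ₙ x)         ∎
    where open ≡-Reasoning

  ·-homo-neg : ∀ i x → (ℤ.- i) · x ≡ - (i · x)
  ·-homo-neg (ℤ.+ zero)  x = sym ε⁻¹≈ε
  ·-homo-neg (ℤ.+ suc n) x = refl
  ·-homo-neg -[1+ n ]  x = sym (⁻¹-involutive _)

  parity : ℕ → ℕ
  parity zero          = 0
  parity (suc zero)    = 1
  parity (suc (suc n)) = parity n

  parityℤ : ℤ → ℤ
  parityℤ (ℤ.+ n)    = ℤ.+ parity n
  parityℤ -[1+ n ] = ℤ.+ parity (suc n)

  module _ {x : A} (x+x≡0 : x + x ≡ 0#) where

    ·ₙ-parity : ∀ n → n ·ₙ x ≡ parity n ·ₙ x
    ·ₙ-parity zero          = refl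
    ·ₙ-parity (suc zero)    = refl
    ·ₙ-parity (suc (suc n)) = begin
      x + (x + n ·ₙ x)   ≡⟨ assoc x x _ ⟨
      (x + x) + n ·ₙ x   ≡⟨ cong (_+ n ·ₙ x) x+x≡0 ⟩
      0# + n ·ₙ x        ≡⟨ identityˡ _ ⟩
      n ·ₙ x             ≡⟨ ·ₙ-parity n ⟩
      parity n ·ₙ x      ∎
      where open ≡-Reasoning

    neg-·ₙ-parity : ∀ n → - (parity n ·ₙ x) ≡ parity n ·ₙ x
    neg-·ₙ-parity zero          = ε⁻¹≈ε
    neg-·ₙ-parity (suc zero)    = sym (inverseʳ-unique (x + 0#) (x + 0#) (trans (cong (λ t → t + t) (identityʳ x)) x+x≡0))
    neg-·ₙ-parity (suc (suc n)) = neg-·ₙ-parity n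

    ·-parity : ∀ i → i · x ≡ parityℤ i · x
    ·-parity (ℤ.+ n)    = ·ₙ-parity n
    ·-parity -[1+ n ] = trans (cong -_ (·ₙ-parity (suc n))) (neg-·ₙ-parity (suc n))

  infixl 6 _⊕_ _⊝_
  infix  7 ⊝_

  data Expr (n : ℕ) : Set where
    var : Fin n → Expr n
    _⊕_ : Expr n → Expr n → Expr n
    ⊝_  : Expr n → Expr n
    ⊘   : Expr n

  _⊝_ : ∀ {n} → Expr n → Expr n → Expr n
  e ⊝ f = e ⊕ ⊝ f

  x₀ : ∀ {n} → Expr (suc n)
  x₀ = var zero
  x₁ : ∀ {n} → Expr (suc (suc n))
  x₁ = var (suc zero)
  x₂ : ∀ {n} → Expr (suc (suc (suc n)))
  x₂ = var (suc (suc zero))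
  x₃ : ∀ {n} → Expr (suc (suc (suc (suc n))))
  x₃ = var (suc (suc (suc zero)))

  infixr 5 _▷_ _▶_

  data Env : ℕ → Set where
    ε   : Env 0
    _▷_ : ∀ {n} → A → Env n → Env (suc n)
    _▶_ : ∀ {n} → Σ A (λ x → x + x ≡ 0#) → Env n → Env (suc n)

  lookupEnv : ∀ {n} → Env n → Fin n → A
  lookupEnv (x ▷ ρ)       zero    = x
  lookupEnv ((x , _) ▶ ρ) zero    = x
  lookupEnv (_ ▷ ρ)       (suc i) = lookupEnv ρ i
  lookupEnv (_ ▶ ρ)       (suc i) = lookupEnv ρ i

  ⟦_⟧ : ∀ {n} → Expr n → Env n → A
  ⟦ var i ⟧ ρ = lookupEnv ρ i
  ⟦ e ⊕ f ⟧ ρ = ⟦ e ⟧ ρ + ⟦ f ⟧ ρ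
  ⟦ ⊝ e ⟧   ρ = - ⟦ e ⟧ ρ
  ⟦ ⊘ ⟧     ρ = 0#

  Normal : ℕ → Set
  Normal n = Vec ℤ n

  ⟦_⟧ₙ : ∀ {n} → Normal n → Env n → A
  ⟦ [] ⟧ₙ     ε             = 0#
  ⟦ k ∷ ks ⟧ₙ (x ▷ ρ)       = k · x + ⟦ ks ⟧ₙ ρ
  ⟦ k ∷ ks ⟧ₙ ((x , _) ▶ ρ) = k · x + ⟦ ks ⟧ₙ ρ

  unit : ∀ {n} → Fin n → Normal n
  unit {suc n} zero    = ℤ.+ 1 ∷ replicate n (ℤ.+ 0)
  unit {suc n} (suc i) = ℤ.+ 0 ∷ unit i

  linear : ∀ {n} → Expr n → Normal n
  linear (var i)     = unit i
  linear (e ⊕ f)     = zipWith ℤ._+_ (linear e) (linear f)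
  linear (⊝ e)       = map ℤ.-_ (linear e)
  linear {n} ⊘       = replicate n (ℤ.+ 0)

  reduce : ∀ {n} → Env n → Normal n → Normal n
  reduce ε       []       = []
  reduce (_ ▷ ρ) (k ∷ ks) = k ∷ reduce ρ ks
  reduce (_ ▶ ρ) (k ∷ ks) = parityℤ k ∷ reduce ρ ks

  normalise : ∀ {n} → Env n → Expr n → Normal n
  normalise ρ e = reduce ρ (linear e)

  ⟦replicate0⟧ : ∀ {n} (ρ : Env n) → ⟦ replicate n (ℤ.+ 0) ⟧ₙ ρ ≡ 0#
  ⟦replicate0⟧ ε       = refl
  ⟦replicate0⟧ (_ ▷ ρ) = trans (identityˡ _) (⟦replicate0⟧ ρ)
  ⟦replicate0⟧ (_ ▶ ρ) = trans (identityˡ _) (⟦replicate0⟧ ρ)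

  ⟦unit⟧ : ∀ {n} (ρ : Env n) i → ⟦ unit i ⟧ₙ ρ ≡ lookupEnv ρ i
  ⟦unit⟧ (x ▷ ρ)       zero    = trans (cong₂ _+_ (identityʳ x) (⟦replicate0⟧ ρ)) (identityʳ x)
  ⟦unit⟧ ((x , _) ▶ ρ) zero    = trans (cong₂ _+_ (identityʳ x) (⟦replicate0⟧ ρ)) (identityʳ x)
  ⟦unit⟧ (_ ▷ ρ)       (suc i) = trans (identityˡ _) (⟦unit⟧ ρ i)
  ⟦unit⟧ (_ ▶ ρ)       (suc i) = trans (identityˡ _) (⟦unit⟧ ρ i)

  ⟦zipWith+⟧ : ∀ {n} (ρ : Env n) u w → ⟦ zipWith ℤ._+_ u w ⟧ₙ ρ ≡ ⟦ u ⟧ₙ ρ + ⟦ w ⟧ₙ ρ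
  ⟦zipWith+⟧ ε             []      []      = sym (identityˡ 0#)
  ⟦zipWith+⟧ (x ▷ ρ)       (k ∷ u) (l ∷ w) = trans (cong₂ _+_ (·-homo-+ k l x) (⟦zipWith+⟧ ρ u w)) (interchange _ _ _ _)
  ⟦zipWith+⟧ ((x , _) ▶ ρ) (k ∷ u) (l ∷ w) = trans (cong₂ _+_ (·-homo-+ k l x) (⟦zipWith+⟧ ρ u w)) (interchange _ _ _ _)

  ⟦map-⟧ : ∀ {n} (ρ : Env n) u → ⟦ map ℤ.-_ u ⟧ₙ ρ ≡ - ⟦ u ⟧ₙ ρ
  ⟦map-⟧ ε             []      = sym ε⁻¹≈ε
  ⟦map-⟧ (x ▷ ρ)       (k ∷ u) = trans (cong₂ _+_ (·-homo-neg k x) (⟦map-⟧ ρ u)) (sym (neg-+ _ _))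
  ⟦map-⟧ ((x , _) ▶ ρ) (k ∷ u) = trans (cong₂ _+_ (·-homo-neg k x) (⟦map-⟧ ρ u)) (sym (neg-+ _ _))

  ⟦reduce⟧ : ∀ {n} (ρ : Env n) u → ⟦ reduce ρ u ⟧ₙ ρ ≡ ⟦ u ⟧ₙ ρ
  ⟦reduce⟧ ε               []      = refl
  ⟦reduce⟧ (x ▷ ρ)         (k ∷ u) = cong (k · x +_) (⟦reduce⟧ ρ u)
  ⟦reduce⟧ ((x , x+x≡0) ▶ ρ) (k ∷ u) = cong₂ _+_ (sym (·-parity x+x≡0 k)) (⟦reduce⟧ ρ u)

  ⟦linear⟧ : ∀ {n} (ρ : Env n) e → ⟦ linear e ⟧ₙ ρ ≡ ⟦ e ⟧ ρ
  ⟦linear⟧ ρ (var i) = ⟦unit⟧ ρ i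
  ⟦linear⟧ ρ (e ⊕ f) = trans (⟦zipWith+⟧ ρ (linear e) (linear f)) (cong₂ _+_ (⟦linear⟧ ρ e) (⟦linear⟧ ρ f))
  ⟦linear⟧ ρ (⊝ e)   = trans (⟦map-⟧ ρ (linear e)) (cong -_ (⟦linear⟧ ρ e))
  ⟦linear⟧ ρ ⊘       = ⟦replicate0⟧ ρ

  ⟦normalise⟧ : ∀ {n} (ρ : Env n) e → ⟦ normalise ρ e ⟧ₙ ρ ≡ ⟦ e ⟧ ρ
  ⟦normalise⟧ ρ e = trans (⟦reduce⟧ ρ (linear e)) (⟦linear⟧ ρ e)

  solve : ∀ {n} (ρ : Env n) (l r : Expr n) → normalise ρ l ≡ normalise ρ r → ⟦ l ⟧ ρ ≡ ⟦ r ⟧ ρ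
  solve ρ l r eq = trans (sym (⟦normalise⟧ ρ l)) (trans (cong (λ u → ⟦ u ⟧ₙ ρ) eq) (⟦normalise⟧ ρ r))

  solve-from : ∀ {n} (ρ : Env n) (e f l r : Expr n) → ⟦ e ⟧ ρ ≡ ⟦ f ⟧ ρ →
               normalise ρ (l ⊝ r) ≡ normalise ρ (e ⊝ f) → ⟦ l ⟧ ρ ≡ ⟦ r ⟧ ρ
  solve-from ρ e f l r e≡f eq = x∙y⁻¹≈ε⇒x≈y _ _ (begin
    ⟦ l ⟧ ρ + - ⟦ r ⟧ ρ    ≡⟨ solve ρ (l ⊝ r) (e ⊝ f) eq ⟩
    ⟦ e ⟧ ρ + - ⟦ f ⟧ ρ    ≡⟨ cong (_+ - ⟦ f ⟧ ρ) e≡f ⟩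
    ⟦ f ⟧ ρ + - ⟦ f ⟧ ρ    ≡⟨ inverseʳ _ ⟩
    0#                     ∎)
    where open ≡-Reasoning

module GroupLemmas {v : ℕ} (G : FinAbGroup v) where

  open import Algebra.Bundles using (AbelianGroup)
  import Algebra.Properties.AbelianGroup as AbelianGroupProperties
  open import Data.Bool.Base using (true; _∨_)
  open import Data.Fin.Permutation using (permutation)
  open import Data.Nat.Base as ℕ using (ℕ)
  open import Data.Nat.Properties using (+-cancelʳ-≡)
  import Data.Vec.Base as Vec
  open import Data.Vec.Properties using (lookup∘tabulate; []=⇒lookup; lookup⇒[]=)
  open import Level using (0ℓ)
  open import Relation.Nullary.Decidable using (⌊_⌋)

  open FinAbGroup G
  open IsAbelianGroup isAbelianGroup using (assoc; identityˡ)
  private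
    abelianGroup : AbelianGroup 0ℓ 0ℓ
    abelianGroup = record { isAbelianGroup = isAbelianGroup }

  open AbelianGroupProperties abelianGroup using (∙-cancelʳ; inverseʳ-unique; ⁻¹-involutive)
  open AbelianGroupSolver G

  infix 4 _≢?_

  _≢?_ : ∀ (x y : Fin v) → Dec (x ≢ y)
  x ≢? y = ¬? (x ≟ y)

  Ω₁? : ∀ a → Dec (Ω₁ G a)
  Ω₁? a = a + a ≟ 0#

  neg-involutive : ∀ x → - (- x) ≡ x
  neg-involutive = ⁻¹-involutive

  Ω₁-0# : Ω₁ G 0#
  Ω₁-0# = identityˡ 0#

  Ω₁⇒-≡ : ∀ {a} → Ω₁ G a → - a ≡ a
  Ω₁⇒-≡ {a} a+a≡0 = sym (inverseʳ-unique a a a+a≡0)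

  Ω₁-resp-≡ : ∀ {a b} → a ≡ b → Ω₁ G a → Ω₁ G b
  Ω₁-resp-≡ refl Ωa = Ωa

  ¬Ω₁⇒≢0# : ∀ {a} → ¬ Ω₁ G a → a ≢ 0#
  ¬Ω₁⇒≢0# ¬Ωa a≡0 = ¬Ωa (Ω₁-resp-≡ (sym a≡0) Ω₁-0#)

  ¬Ω₁⇒≢ : ∀ {a h} → ¬ Ω₁ G a → Ω₁ G h → a ≢ h
  ¬Ω₁⇒≢ ¬Ωa Ωh a≡h = ¬Ωa (Ω₁-resp-≡ (sym a≡h) Ωh)

  Ω₁-neg : ∀ {a} → Ω₁ G (- a) → Ω₁ G a
  Ω₁-neg {a} Ω-a = sym (solve-from (a ▷ ε) (⊝ x₀ ⊕ ⊝ x₀) ⊘ ⊘ (x₀ ⊕ x₀) Ω-a refl)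

  +-cancelʳ : ∀ {x y c} → x + c ≡ y + c → x ≡ y
  +-cancelʳ {x} {y} {c} = ∙-cancelʳ c x y

  x≡z+x⇒z≡0# : ∀ {z x} → x ≡ z + x → z ≡ 0#
  x≡z+x⇒z≡0# {z} {x} x≡z+x = sym (+-cancelʳ (trans (identityˡ x) x≡z+x))

  ∑-translate : ∀ (f : Fin v → ℕ) c → ∑[ x < v ] f (x + c) ≡ ∑[ x < v ] f x
  ∑-translate f c = sym (∑-permute f (permutation (_+ c) (_+ - c) left right))
    where
    left : ∀ x → (x + - c) + c ≡ x
    left x = solve (x ▷ c ▷ ε) ((x₀ ⊝ x₁) ⊕ x₁) x₀ refl
    right : ∀ x → (x + c) + - c ≡ x
    right x = solve (x ▷ c ▷ ε) ((x₀ ⊕ x₁) ⊝ x₁) x₀ refl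

  count-translate-∈ : ∀ (X : Subset v) c → count (λ q → q + c ∈? X) ≡ ∣ X ∣
  count-translate-∈ X c = trans (∑-translate (λ x → 𝟙 (x ∈? X)) c) (sym (∣p∣≡count∈ X))

  module _ {p q r s : Fin v} where

    OneOf4 : Fin v → Set
    OneOf4 x = x ≡ p ⊎ x ≡ q ⊎ x ≡ r ⊎ x ≡ s

    oneOf4? : ∀ x → Dec (OneOf4 x)
    oneOf4? x = x ≟ p ⊎-dec x ≟ q ⊎-dec x ≟ r ⊎-dec x ≟ s

    lookup-set4 : ∀ x → Vec.lookup (set4 G p q r s) x ≡ (⌊ x ≟ p ⌋ ∨ ⌊ x ≟ q ⌋ ∨ ⌊ x ≟ r ⌋ ∨ ⌊ x ≟ s ⌋)
    lookup-set4 x = lookup∘tabulate _ x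

    ∈-set4⁻ : ∀ {x} → x ∈ set4 G p q r s → OneOf4 x
    ∈-set4⁻ {x} x∈ with trans (sym (lookup-set4 x)) ([]=⇒lookup x∈)
    ... | lookup≡true with x ≟ p | x ≟ q | x ≟ r | x ≟ s
    ... | yes x≡p | _       | _       | _       = inj₁ x≡p
    ... | no _    | yes x≡q | _       | _       = inj₂ (inj₁ x≡q)
    ... | no _    | no _    | yes x≡r | _       = inj₂ (inj₂ (inj₁ x≡r))
    ... | no _    | no _    | no _    | yes x≡s = inj₂ (inj₂ (inj₂ x≡s))
    ... | no _    | no _    | no _    | no _ with lookup≡true
    ...   | ()

    ∈-set4⁺ : ∀ {x} → OneOf4 x → x ∈ set4 G p q r s
    ∈-set4⁺ {x} x∈ = lookup⇒[]= x _ (trans (lookup-set4 x) (decide x∈))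
      where
      decide : OneOf4 x → (⌊ x ≟ p ⌋ ∨ ⌊ x ≟ q ⌋ ∨ ⌊ x ≟ r ⌋ ∨ ⌊ x ≟ s ⌋) ≡ true
      decide x∈ with x ≟ p | x ≟ q | x ≟ r | x ≟ s | x∈
      ... | yes _ | _     | _     | _     | _ = refl
      ... | no _  | yes _ | _     | _     | _ = refl
      ... | no _  | no _  | yes _ | _     | _ = refl
      ... | no _  | no _  | no _  | yes _ | _ = refl
      ... | no x≢p | no _ | no _  | no _  | inj₁ x≡p = ⊥-elim (x≢p x≡p)
      ... | no _  | no x≢q | no _ | no _  | inj₂ (inj₁ x≡q) = ⊥-elim (x≢q x≡q)
      ... | no _  | no _  | no x≢r | no _ | inj₂ (inj₂ (inj₁ x≡r)) = ⊥-elim (x≢r x≡r)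
      ... | no _  | no _  | no _  | no x≢s | inj₂ (inj₂ (inj₂ x≡s)) = ⊥-elim (x≢s x≡s)

    set4∋₁ : p ∈ set4 G p q r s
    set4∋₁ = ∈-set4⁺ (inj₁ refl)
    set4∋₂ : q ∈ set4 G p q r s
    set4∋₂ = ∈-set4⁺ (inj₂ (inj₁ refl))
    set4∋₃ : r ∈ set4 G p q r s
    set4∋₃ = ∈-set4⁺ (inj₂ (inj₂ (inj₁ refl)))
    set4∋₄ : s ∈ set4 G p q r s
    set4∋₄ = ∈-set4⁺ (inj₂ (inj₂ (inj₂ refl)))

    set4⊆ : ∀ {X : Subset v} → p ∈ X → q ∈ X → r ∈ X → s ∈ X → set4 G p q r s ⊆ X
    set4⊆ p∈ q∈ r∈ s∈ x∈ with ∈-set4⁻ x∈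
    ... | inj₁ refl                = p∈
    ... | inj₂ (inj₁ refl)         = q∈
    ... | inj₂ (inj₂ (inj₁ refl))  = r∈
    ... | inj₂ (inj₂ (inj₂ refl))  = s∈

  record Distinct4 (p q r s : Fin v) : Set where
    field
      p≢q : p ≢ q
      p≢r : p ≢ r
      p≢s : p ≢ s
      q≢r : q ≢ r
      q≢s : q ≢ s
      r≢s : r ≢ s

  module _ {p q r s : Fin v} (distinct : Distinct4 p q r s) where

    open Distinct4 distinct

    ∣set4∣≡4 : ∣ set4 G p q r s ∣ ≡ 4
    ∣set4∣≡4 = begin
      ∣ set4 G p q r s ∣                                        ≡⟨ ∣p∣≡count∈ (set4 G p q r s) ⟩
      ∑[ x < v ] 𝟙 (x ∈? set4 G p q r s)                        ≡⟨ sum-cong-≗ split ⟩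
      ∑[ x < v ] (𝟙 (x ≟ p) ℕ.+ (𝟙 (x ≟ q) ℕ.+ (𝟙 (x ≟ r) ℕ.+ 𝟙 (x ≟ s)))) ≡⟨ ∑-𝟙≡+ p _ ⟩
      1 ℕ.+ ∑[ x < v ] (𝟙 (x ≟ q) ℕ.+ (𝟙 (x ≟ r) ℕ.+ 𝟙 (x ≟ s)))          ≡⟨ cong ℕ.suc (∑-𝟙≡+ q _) ⟩
      2 ℕ.+ ∑[ x < v ] (𝟙 (x ≟ r) ℕ.+ 𝟙 (x ≟ s))                         ≡⟨ cong (2 ℕ.+_) (∑-𝟙≡+ r _) ⟩
      3 ℕ.+ ∑[ x < v ] 𝟙 (x ≟ s)                                         ≡⟨ cong (3 ℕ.+_) (∑-𝟙≡ s) ⟩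
      4                                                         ∎
      where
      open ≡-Reasoning
      ∑-𝟙≡+ : ∀ j (f : Fin v → ℕ) → ∑[ x < v ] (𝟙 (x ≟ j) ℕ.+ f x) ≡ 1 ℕ.+ ∑[ x < v ] f x
      ∑-𝟙≡+ j f = trans (∑-distrib-+ (λ x → 𝟙 (x ≟ j)) f) (cong (ℕ._+ ∑[ x < v ] f x) (∑-𝟙≡ j))
      apart : ∀ {x a b} → a ≢ b → ¬ (x ≡ a × x ≡ b)
      apart a≢b (x≡a , x≡b) = a≢b (trans (sym x≡a) x≡b)
      split : ∀ x → 𝟙 (x ∈? set4 G p q r s) ≡ 𝟙 (x ≟ p) ℕ.+ (𝟙 (x ≟ q) ℕ.+ (𝟙 (x ≟ r) ℕ.+ 𝟙 (x ≟ s)))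
      split x = begin
        𝟙 (x ∈? set4 G p q r s)  ≡⟨ 𝟙-cong (x ∈? set4 G p q r s) (oneOf4? x) ∈-set4⁻ ∈-set4⁺ ⟩
        𝟙 (oneOf4? x)            ≡⟨ 𝟙-⊎ (x ≟ p) _ (λ { (x≡p , inj₁ x≡q) → apart p≢q (x≡p , x≡q)
                                                  ; (x≡p , inj₂ (inj₁ x≡r)) → apart p≢r (x≡p , x≡r)
                                                  ; (x≡p , inj₂ (inj₂ x≡s)) → apart p≢s (x≡p , x≡s) }) ⟩
        _                        ≡⟨ cong (𝟙 (x ≟ p) ℕ.+_) (𝟙-⊎ (x ≟ q) _ (λ { (x≡q , inj₁ x≡r) → apart q≢r (x≡q , x≡r)
                                                                    ; (x≡q , inj₂ x≡s) → apart q≢s (x≡q , x≡s) })) ⟩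
        _                        ≡⟨ cong (λ t → 𝟙 (x ≟ p) ℕ.+ (𝟙 (x ≟ q) ℕ.+ t)) (𝟙-⊎ (x ≟ r) (x ≟ s) (apart r≢s)) ⟩
        _                        ∎

    set4≡ : ∀ {X : Subset v} → ∣ X ∣ ≡ 4 → p ∈ X → q ∈ X → r ∈ X → s ∈ X → set4 G p q r s ≡ X
    set4≡ ∣X∣≡4 p∈ q∈ r∈ s∈ = ⊆∧∣∣≡⇒≡ (set4⊆ p∈ q∈ r∈ s∈) (trans ∣set4∣≡4 (sym ∣X∣≡4))

  module _ {X : Subset v} (∣X∣≡4 : ∣ X ∣ ≡ 4) {c : Fin v} (c∈X : c ∈ X) where

    private
      0#+c∈X : 0# + c ∈ X
      0#+c∈X = subst (_∈ X) (sym (identityˡ c)) c∈X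

    count-offsets≢0 : count (λ q → q + c ∈? X ×-dec q ≢? 0#) ≡ 3
    count-offsets≢0 = +-cancelʳ-≡ 1 _ 3 (begin
      count (λ q → q + c ∈? X ×-dec q ≢? 0#) ℕ.+ 1  ≡⟨ count-remove (λ q → q + c ∈? X) 0#+c∈X ⟩
      count (λ q → q + c ∈? X)                   ≡⟨ count-translate-∈ X c ⟩
      ∣ X ∣                                      ≡⟨ ∣X∣≡4 ⟩
      4                                          ∎)
      where open ≡-Reasoning

    count-offsets≢0,≢ : ∀ {p} → p + c ∈ X → p ≢ 0# → count (λ q → (q + c ∈? X ×-dec q ≢? 0#) ×-dec q ≢? p) ≡ 2
    count-offsets≢0,≢ p+c∈X p≢0 = +-cancelʳ-≡ 1 _ 2 (trans
      (count-remove (λ q → q + c ∈? X ×-dec q ≢? 0#) (p+c∈X , p≢0)) count-offsets≢0)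

  module Coset4 (a b d c : Fin v) where

    Pattern : Fin v → Set
    Pattern = OneOf4 {0#} {a} {b} {d}

    Shape : Subset v
    Shape = set4 G c (a + c) (b + c) (d + c)

    ∈⁻ : ∀ {x} → x ∈ Shape → Σ (Fin v) (λ z → Pattern z × x ≡ z + c)
    ∈⁻ x∈ with ∈-set4⁻ x∈
    ... | inj₁ x≡c                 = 0# , inj₁ refl , trans x≡c (sym (identityˡ c))
    ... | inj₂ (inj₁ x≡a+c)        = a , inj₂ (inj₁ refl) , x≡a+c
    ... | inj₂ (inj₂ (inj₁ x≡b+c)) = b , inj₂ (inj₂ (inj₁ refl)) , x≡b+c
    ... | inj₂ (inj₂ (inj₂ x≡d+c)) = d , inj₂ (inj₂ (inj₂ refl)) , x≡d+c

    ∈⁺ : ∀ {z} → Pattern z → z + c ∈ Shape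
    ∈⁺ (inj₁ refl)                = subst (_∈ Shape) (sym (identityˡ c)) set4∋₁
    ∈⁺ (inj₂ (inj₁ refl))         = set4∋₂
    ∈⁺ (inj₂ (inj₂ (inj₁ refl)))  = set4∋₃
    ∈⁺ (inj₂ (inj₂ (inj₂ refl)))  = set4∋₄

    offset⁻ : ∀ {x z w} → x ≡ z + c → w + x ∈ Shape → Σ (Fin v) (λ z′ → Pattern z′ × w + z ≡ z′)
    offset⁻ {z = z} {w} refl w+x∈ with ∈⁻ w+x∈
    ... | z′ , Pz′ , w+x≡z′+c = z′ , Pz′ , +-cancelʳ (trans (assoc w z c) w+x≡z′+c)

    offset-as-difference : ∀ {x w} → x ∈ Shape → w + x ∈ Shape →
                           Σ (Fin v) (λ z → Σ (Fin v) (λ z′ → Pattern z × Pattern z′ × z′ + - z ≡ w))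
    offset-as-difference {w = w} x∈ w+x∈ with ∈⁻ x∈
    ... | z , Pz , x≡z+c with offset⁻ x≡z+c w+x∈
    ...   | z′ , Pz′ , w+z≡z′ = z , z′ , Pz , Pz′ , solve-from (w ▷ z ▷ z′ ▷ ε) x₂ (x₀ ⊕ x₁) (x₂ ⊝ x₁) x₀ (sym w+z≡z′) refl

    module Subgroup (pattern-sub : ∀ {z w} → Pattern z → Pattern w → Pattern (w + - z)) where

      pattern-neg : ∀ {z} → Pattern z → Pattern (- z)
      pattern-neg Pz = subst Pattern (identityˡ _) (pattern-sub Pz (inj₁ refl))

      pattern-+ : ∀ {z w} → Pattern z → Pattern w → Pattern (z + w)
      pattern-+ {z} {w} Pz Pw = subst Pattern (cong (z +_) (⁻¹-involutive w)) (pattern-sub (pattern-neg Pw) Pz)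

      translate-∈ : ∀ {x z} → x ∈ Shape → Pattern z → z + x ∈ Shape
      translate-∈ {z = z} x∈ Pz with ∈⁻ x∈
      ... | z₁ , Pz₁ , refl = subst (_∈ Shape) (assoc z z₁ c) (∈⁺ (pattern-+ Pz Pz₁))

      offset∈Pattern : ∀ {x w} → x ∈ Shape → w + x ∈ Shape → Pattern w
      offset∈Pattern x∈ w+x∈ with offset-as-difference x∈ w+x∈
      ... | _ , _ , Pz , Pz′ , z′-z≡w = subst Pattern z′-z≡w (pattern-sub Pz Pz′)

  c≢z+c : ∀ {z c} → z ≢ 0# → c ≢ z + c
  c≢z+c z≢0 c≡z+c = z≢0 (x≡z+x⇒z≡0# c≡z+c)

  z+c≢w+c : ∀ {z w c} → z ≢ w → z + c ≢ w + c
  z+c≢w+c z≢w = z≢w ∘ +-cancelʳ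

  set4-cong : ∀ {p q r s p′ q′ r′ s′} → p ≡ p′ → q ≡ q′ → r ≡ r′ → s ≡ s′ → set4 G p q r s ≡ set4 G p′ q′ r′ s′
  set4-cong refl refl refl refl = refl

module Q₁Sets {v : ℕ} (G : FinAbGroup v) {h₀ : Fin v} (h₀≢0 : h₀ ≢ FinAbGroup.0# G) (Ωh₀ : Ω₁ G h₀) where

  open import Data.Nat.Base as ℕ using (ℕ)

  open FinAbGroup G
  open IsAbelianGroup isAbelianGroup using (assoc; identityˡ; identityʳ)
  open AbelianGroupSolver G
  open GroupLemmas G

  shape₁ : Fin v → Fin v → Subset v
  shape₁ c a = set4 G c (a + c) (- a + c) (h₀ + c)

  ¬Ω₁⇒distinct : ∀ {c a} → ¬ Ω₁ G a → Distinct4 c (a + c) (- a + c) (h₀ + c)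
  ¬Ω₁⇒distinct {c} {a} ¬Ωa = record
    { p≢q = c≢z+c (¬Ω₁⇒≢0# ¬Ωa)
    ; p≢r = c≢z+c (¬Ω₁⇒≢0# (¬Ωa ∘ Ω₁-neg))
    ; p≢s = c≢z+c h₀≢0
    ; q≢r = z+c≢w+c (λ a≡-a → ¬Ωa (solve-from (a ▷ ε) x₀ (⊝ x₀) (x₀ ⊕ x₀) ⊘ a≡-a refl))
    ; q≢s = z+c≢w+c (¬Ω₁⇒≢ ¬Ωa Ωh₀)
    ; r≢s = z+c≢w+c (¬Ω₁⇒≢ (¬Ωa ∘ Ω₁-neg) Ωh₀)
    }

  GenericQ₁ : Fin v → Set
  GenericQ₁ a = ¬ Ω₁ G a × a + a ≢ h₀

  genericQ₁? : ∀ a → Dec (GenericQ₁ a)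
  genericQ₁? a = ¬? (Ω₁? a) ×-dec a + a ≢? h₀

  CyclicQ₁ : Fin v → Set
  CyclicQ₁ a = a + a ≡ h₀

  cyclicQ₁? : ∀ a → Dec (CyclicQ₁ a)
  cyclicQ₁? a = a + a ≟ h₀

  cyclicQ₁⇒¬Ω₁ : ∀ {a} → CyclicQ₁ a → ¬ Ω₁ G a
  cyclicQ₁⇒¬Ω₁ 2a≡h₀ Ωa = h₀≢0 (trans (sym 2a≡h₀) Ωa)

  module Q₁Coset {c a : Fin v} (¬Ωa : ¬ Ω₁ G a) where

    open Coset4 a (- a) h₀ c public

    ∣Shape∣≡4 : ∣ Shape ∣ ≡ 4
    ∣Shape∣≡4 = ∣set4∣≡4 (¬Ω₁⇒distinct ¬Ωa)

    Ω₁-offset≡h₀ : ∀ {w} → w + c ∈ Shape → Ω₁ G w → w ≢ 0# → w ≡ h₀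
    Ω₁-offset≡h₀ {w} w+c∈ Ωw w≢0 with offset⁻ (sym (identityˡ c)) w+c∈
    ... | z , Pz , w+0≡z with trans (sym (identityʳ w)) w+0≡z | Pz
    ...   | refl | inj₁ refl                = ⊥-elim (w≢0 refl)
    ...   | refl | inj₂ (inj₁ refl)         = ⊥-elim (¬Ωa Ωw)
    ...   | refl | inj₂ (inj₂ (inj₁ refl))  = ⊥-elim (¬Ωa (Ω₁-neg Ωw))
    ...   | refl | inj₂ (inj₂ (inj₂ refl))  = refl

  module GenericQ₁Coset {c a : Fin v} (ga : GenericQ₁ a) where

    private
      ¬Ωa   : ¬ Ω₁ G a
      ¬Ωa   = proj₁ ga
      2a≢h₀ : a + a ≢ h₀
      2a≢h₀ = proj₂ ga
      ρ : Env 2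
      ρ = (h₀ , Ωh₀) ▶ a ▷ ε

    open Q₁Coset {c} {a} ¬Ωa public

    h₀-offset : ∀ {z z′} → Pattern z → Pattern z′ → h₀ + z ≡ z′ → z ≡ 0# ⊎ z ≡ h₀
    h₀-offset (inj₁ refl)               _ _ = inj₁ refl
    h₀-offset (inj₂ (inj₂ (inj₂ refl))) _ _ = inj₂ refl
    h₀-offset (inj₂ (inj₁ refl)) (inj₁ refl) e                       = ⊥-elim (¬Ω₁⇒≢ ¬Ωa Ωh₀ (solve-from ρ (x₀ ⊕ x₁) ⊘ x₁ x₀ e refl))
    h₀-offset (inj₂ (inj₁ refl)) (inj₂ (inj₁ refl)) e                = ⊥-elim (h₀≢0 (solve-from ρ (x₀ ⊕ x₁) x₁ x₀ ⊘ e refl))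
    h₀-offset (inj₂ (inj₁ refl)) (inj₂ (inj₂ (inj₁ refl))) e         = ⊥-elim (2a≢h₀ (solve-from ρ (x₀ ⊕ x₁) (⊝ x₁) (x₁ ⊕ x₁) x₀ e refl))
    h₀-offset (inj₂ (inj₁ refl)) (inj₂ (inj₂ (inj₂ refl))) e         = ⊥-elim (¬Ω₁⇒≢0# ¬Ωa (solve-from ρ (x₀ ⊕ x₁) x₀ x₁ ⊘ e refl))
    h₀-offset (inj₂ (inj₂ (inj₁ refl))) (inj₁ refl) e                = ⊥-elim (¬Ω₁⇒≢ ¬Ωa Ωh₀ (solve-from ρ ⊘ (x₀ ⊝ x₁) x₁ x₀ (sym e) refl))
    h₀-offset (inj₂ (inj₂ (inj₁ refl))) (inj₂ (inj₁ refl)) e         = ⊥-elim (2a≢h₀ (solve-from ρ x₁ (x₀ ⊝ x₁) (x₁ ⊕ x₁) x₀ (sym e) refl))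
    h₀-offset (inj₂ (inj₂ (inj₁ refl))) (inj₂ (inj₂ (inj₁ refl))) e  = ⊥-elim (h₀≢0 (solve-from ρ (x₀ ⊝ x₁) (⊝ x₁) x₀ ⊘ e refl))
    h₀-offset (inj₂ (inj₂ (inj₁ refl))) (inj₂ (inj₂ (inj₂ refl))) e  = ⊥-elim (¬Ω₁⇒≢0# ¬Ωa (solve-from ρ x₀ (x₀ ⊝ x₁) x₁ ⊘ (sym e) refl))

    ¬Ω₁-offset : ∀ {z z′ q} → z ≡ 0# ⊎ z ≡ h₀ → Pattern z′ → q + z ≡ z′ → ¬ Ω₁ G q → z′ ≡ a ⊎ z′ ≡ - a
    ¬Ω₁-offset _ (inj₂ (inj₁ refl))        _ _ = inj₁ refl
    ¬Ω₁-offset _ (inj₂ (inj₂ (inj₁ refl))) _ _ = inj₂ refl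
    ¬Ω₁-offset {q = q} (inj₁ refl) (inj₁ refl)               e ¬Ωq = ⊥-elim (¬Ω₁⇒≢0# ¬Ωq (trans (sym (identityʳ q)) e))
    ¬Ω₁-offset {q = q} (inj₂ refl) (inj₁ refl)               e ¬Ωq = ⊥-elim (¬Ω₁⇒≢ ¬Ωq Ωh₀ (solve-from ((h₀ , Ωh₀) ▶ q ▷ ε) (x₁ ⊕ x₀) ⊘ x₁ x₀ e refl))
    ¬Ω₁-offset {q = q} (inj₁ refl) (inj₂ (inj₂ (inj₂ refl))) e ¬Ωq = ⊥-elim (¬Ω₁⇒≢ ¬Ωq Ωh₀ (trans (sym (identityʳ q)) e))
    ¬Ω₁-offset {q = q} (inj₂ refl) (inj₂ (inj₂ (inj₂ refl))) e ¬Ωq = ⊥-elim (¬Ω₁⇒≢0# ¬Ωq (solve-from ((h₀ , Ωh₀) ▶ q ▷ ε) (x₁ ⊕ x₀) x₀ x₁ ⊘ e refl))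

    Representation : Fin v → Fin v → Set
    Representation c′ q = GenericQ₁ q × Shape ≡ shape₁ c′ q

    Choice : Fin v → Fin v → Set
    Choice c′ q = (c′ ≡ c ⊎ c′ ≡ h₀ + c) × (q + c′ ≡ a + c ⊎ q + c′ ≡ - a + c)

    representation⇒choice : ∀ {c′ q} → Representation c′ q → Choice c′ q
    representation⇒choice {q = q} ((¬Ωq , _) , X≡) with ∈⁻ (subst (_ ∈_) (sym X≡) set4∋₁)
    ... | z , Pz , refl with offset⁻ refl (subst (_ ∈_) (sym X≡) set4∋₄) | offset⁻ refl (subst (_ ∈_) (sym X≡) set4∋₂)
    ...   | z₂ , Pz₂ , h₀+z≡z₂ | z₃ , Pz₃ , q+z≡z₃ = base (h₀-offset Pz Pz₂ h₀+z≡z₂) , offsets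
      where
      base : z ≡ 0# ⊎ z ≡ h₀ → z + c ≡ c ⊎ z + c ≡ h₀ + c
      base (inj₁ refl) = inj₁ (identityˡ c)
      base (inj₂ refl) = inj₂ refl
      q+z+c≡ : ∀ {y} → z₃ ≡ y → q + (z + c) ≡ y + c
      q+z+c≡ z₃≡y = trans (sym (assoc q z c)) (cong (_+ c) (trans q+z≡z₃ z₃≡y))
      offsets : q + (z + c) ≡ a + c ⊎ q + (z + c) ≡ - a + c
      offsets with ¬Ω₁-offset (h₀-offset Pz Pz₂ h₀+z≡z₂) Pz₃ q+z≡z₃ ¬Ωq
      ... | inj₁ z₃≡a  = inj₁ (q+z+c≡ z₃≡a)
      ... | inj₂ z₃≡-a = inj₂ (q+z+c≡ z₃≡-a)

    private
      generic-neg : ∀ {b} → GenericQ₁ b → GenericQ₁ (- b)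
      generic-neg {b} (¬Ωb , 2b≢h₀) = ¬Ωb ∘ Ω₁-neg ,
        λ 2[-b]≡h₀ → 2b≢h₀ (solve-from ((h₀ , Ωh₀) ▶ b ▷ ε) x₀ (⊝ x₁ ⊕ ⊝ x₁) (x₁ ⊕ x₁) x₀ (sym 2[-b]≡h₀) refl)

      generic-+h₀ : ∀ {b} → GenericQ₁ b → GenericQ₁ (b + h₀)
      generic-+h₀ {b} (¬Ωb , 2b≢h₀) =
        (λ Ωb+h₀ → ¬Ωb (solve-from ρb ((x₁ ⊕ x₀) ⊕ (x₁ ⊕ x₀)) ⊘ (x₁ ⊕ x₁) ⊘ Ωb+h₀ refl)) ,
        (λ 2[b+h₀]≡h₀ → 2b≢h₀ (solve-from ρb ((x₁ ⊕ x₀) ⊕ (x₁ ⊕ x₀)) x₀ (x₁ ⊕ x₁) x₀ 2[b+h₀]≡h₀ refl))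
        where ρb = (h₀ , Ωh₀) ▶ b ▷ ε

      ρc : Env 3
      ρc = (h₀ , Ωh₀) ▶ a ▷ c ▷ ε

      ∈⁺-via : ∀ {y z} → y ≡ z + c → Pattern z → y ∈ Shape
      ∈⁺-via refl Pz = ∈⁺ Pz

    choice⇒representation : ∀ {c′ q} → Choice c′ q → Representation c′ q
    choice⇒representation {q = q} (inj₁ refl , inj₁ q+c≡a+c) with +-cancelʳ q+c≡a+c
    ... | refl = ga , refl
    choice⇒representation {q = q} (inj₁ refl , inj₂ q+c≡-a+c) with +-cancelʳ q+c≡-a+c
    ... | refl = generic-neg ga , sym (set4≡ (¬Ω₁⇒distinct (¬Ωa ∘ Ω₁-neg)) ∣Shape∣≡4
                   set4∋₁ set4∋₃ (subst (λ t → t + c ∈ Shape) (sym (neg-involutive a)) set4∋₂) set4∋₄)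
    choice⇒representation {q = q} (inj₂ refl , inj₁ q+h₀+c≡a+c)
      with solve-from ((h₀ , Ωh₀) ▶ q ▷ c ▷ a ▷ ε) (x₁ ⊕ (x₀ ⊕ x₂)) (x₃ ⊕ x₂) x₁ (x₃ ⊕ x₀) q+h₀+c≡a+c refl
    ... | refl = generic-+h₀ ga , sym (set4≡ (¬Ω₁⇒distinct (proj₁ (generic-+h₀ ga))) ∣Shape∣≡4
                   set4∋₄
                   (∈⁺-via (solve ρc ((x₁ ⊕ x₀) ⊕ (x₀ ⊕ x₂)) (x₁ ⊕ x₂) refl) (inj₂ (inj₁ refl)))
                   (∈⁺-via (solve ρc (⊝ (x₁ ⊕ x₀) ⊕ (x₀ ⊕ x₂)) (⊝ x₁ ⊕ x₂) refl) (inj₂ (inj₂ (inj₁ refl))))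
                   (∈⁺-via (solve ρc (x₀ ⊕ (x₀ ⊕ x₂)) (⊘ ⊕ x₂) refl) (inj₁ refl)))
    choice⇒representation {q = q} (inj₂ refl , inj₂ q+h₀+c≡-a+c)
      with solve-from ((h₀ , Ωh₀) ▶ q ▷ c ▷ a ▷ ε) (x₁ ⊕ (x₀ ⊕ x₂)) (⊝ x₃ ⊕ x₂) x₁ (⊝ x₃ ⊕ x₀) q+h₀+c≡-a+c refl
    ... | refl = generic-+h₀ (generic-neg ga) , sym (set4≡ (¬Ω₁⇒distinct (proj₁ (generic-+h₀ (generic-neg ga)))) ∣Shape∣≡4
                   set4∋₄
                   (∈⁺-via (solve ρc ((⊝ x₁ ⊕ x₀) ⊕ (x₀ ⊕ x₂)) (⊝ x₁ ⊕ x₂) refl) (inj₂ (inj₂ (inj₁ refl))))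
                   (∈⁺-via (solve ρc (⊝ (⊝ x₁ ⊕ x₀) ⊕ (x₀ ⊕ x₂)) (x₁ ⊕ x₂) refl) (inj₂ (inj₁ refl)))
                   (∈⁺-via (solve ρc (x₀ ⊕ (x₀ ⊕ x₂)) (⊘ ⊕ x₂) refl) (inj₁ refl)))

    fibre-size : ∑[ c′ < v ] ∑[ q < v ] 𝟙 (genericQ₁? q ×-dec (Shape ≟ˢ shape₁ c′ q)) ≡ 4
    fibre-size = begin
      ∑[ c′ < v ] ∑[ q < v ] 𝟙 (genericQ₁? q ×-dec (Shape ≟ˢ shape₁ c′ q))
        ≡⟨ sum-cong-≗ (λ c′ → sum-cong-≗ (λ q → 𝟙-cong _ (choice? c′ q) representation⇒choice choice⇒representation)) ⟩
      ∑[ c′ < v ] ∑[ q < v ] 𝟙 (choice? c′ q)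
        ≡⟨ ∑∑-𝟙× (λ c′ → c′ ≟ c ⊎-dec c′ ≟ h₀ + c) (λ c′ q → q + c′ ≟ a + c ⊎-dec q + c′ ≟ - a + c) 2
                 (λ c′ _ → trans (∑-translate (λ y → 𝟙 (y ≟ a + c ⊎-dec y ≟ - a + c)) c′) (count-pair (Distinct4.q≢r distinct))) ⟩
      count (λ c′ → c′ ≟ c ⊎-dec c′ ≟ h₀ + c) ℕ.* 2
        ≡⟨ cong (ℕ._* 2) (count-pair (Distinct4.p≢s distinct)) ⟩
      4
        ∎
      where
      open ≡-Reasoning
      distinct = ¬Ω₁⇒distinct {c} ¬Ωa
      choice? : ∀ c′ q → Dec (Choice c′ q)
      choice? c′ q = (c′ ≟ c ⊎-dec c′ ≟ h₀ + c) ×-dec (q + c′ ≟ a + c ⊎-dec q + c′ ≟ - a + c)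

  module CyclicQ₁Coset {c a : Fin v} (2a≡h₀ : CyclicQ₁ a) where

    private
      ¬Ωa : ¬ Ω₁ G a
      ¬Ωa = cyclicQ₁⇒¬Ω₁ 2a≡h₀
      ρ : Env 2
      ρ = (h₀ , Ωh₀) ▶ a ▷ ε
      using-2a≡h₀ : ∀ (l r : Expr 2) → normalise ρ (l ⊝ r) ≡ normalise ρ ((x₁ ⊕ x₁) ⊝ x₀) → ⟦ l ⟧ ρ ≡ ⟦ r ⟧ ρ
      using-2a≡h₀ l r = solve-from ρ (x₁ ⊕ x₁) x₀ l r 2a≡h₀
      using-h₀≡2a : ∀ (l r : Expr 2) → normalise ρ (l ⊝ r) ≡ normalise ρ (x₀ ⊝ (x₁ ⊕ x₁)) → ⟦ l ⟧ ρ ≡ ⟦ r ⟧ ρ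
      using-h₀≡2a l r = solve-from ρ x₀ (x₁ ⊕ x₁) l r (sym 2a≡h₀)

    open Q₁Coset {c} {a} ¬Ωa public

    -- {0, a, -a, h₀} is the cyclic group generated by a.
    pattern-sub : ∀ {z w} → Pattern z → Pattern w → Pattern (w + - z)
    pattern-sub (inj₁ refl) (inj₁ refl)                              = inj₁ (solve ρ (⊘ ⊝ ⊘) ⊘ refl)
    pattern-sub (inj₁ refl) (inj₂ (inj₁ refl))                       = inj₂ (inj₁ (solve ρ (x₁ ⊝ ⊘) x₁ refl))
    pattern-sub (inj₁ refl) (inj₂ (inj₂ (inj₁ refl)))                = inj₂ (inj₂ (inj₁ (solve ρ (⊝ x₁ ⊝ ⊘) (⊝ x₁) refl)))
    pattern-sub (inj₁ refl) (inj₂ (inj₂ (inj₂ refl)))                = inj₂ (inj₂ (inj₂ (solve ρ (x₀ ⊝ ⊘) x₀ refl)))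
    pattern-sub (inj₂ (inj₁ refl)) (inj₁ refl)                       = inj₂ (inj₂ (inj₁ (solve ρ (⊘ ⊝ x₁) (⊝ x₁) refl)))
    pattern-sub (inj₂ (inj₁ refl)) (inj₂ (inj₁ refl))                = inj₁ (solve ρ (x₁ ⊝ x₁) ⊘ refl)
    pattern-sub (inj₂ (inj₁ refl)) (inj₂ (inj₂ (inj₁ refl)))         = inj₂ (inj₂ (inj₂ (using-h₀≡2a (⊝ x₁ ⊝ x₁) x₀ refl)))
    pattern-sub (inj₂ (inj₁ refl)) (inj₂ (inj₂ (inj₂ refl)))         = inj₂ (inj₁ (using-h₀≡2a (x₀ ⊝ x₁) x₁ refl))
    pattern-sub (inj₂ (inj₂ (inj₁ refl))) (inj₁ refl)                = inj₂ (inj₁ (solve ρ (⊘ ⊝ ⊝ x₁) x₁ refl))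
    pattern-sub (inj₂ (inj₂ (inj₁ refl))) (inj₂ (inj₁ refl))         = inj₂ (inj₂ (inj₂ (using-2a≡h₀ (x₁ ⊝ ⊝ x₁) x₀ refl)))
    pattern-sub (inj₂ (inj₂ (inj₁ refl))) (inj₂ (inj₂ (inj₁ refl)))  = inj₁ (solve ρ (⊝ x₁ ⊝ ⊝ x₁) ⊘ refl)
    pattern-sub (inj₂ (inj₂ (inj₁ refl))) (inj₂ (inj₂ (inj₂ refl)))  = inj₂ (inj₂ (inj₁ (using-2a≡h₀ (x₀ ⊝ ⊝ x₁) (⊝ x₁) refl)))
    pattern-sub (inj₂ (inj₂ (inj₂ refl))) (inj₁ refl)                = inj₂ (inj₂ (inj₂ (solve ρ (⊘ ⊝ x₀) x₀ refl)))
    pattern-sub (inj₂ (inj₂ (inj₂ refl))) (inj₂ (inj₁ refl))         = inj₂ (inj₂ (inj₁ (using-2a≡h₀ (x₁ ⊝ x₀) (⊝ x₁) refl)))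
    pattern-sub (inj₂ (inj₂ (inj₂ refl))) (inj₂ (inj₂ (inj₁ refl)))  = inj₂ (inj₁ (using-h₀≡2a (⊝ x₁ ⊝ x₀) x₁ refl))
    pattern-sub (inj₂ (inj₂ (inj₂ refl))) (inj₂ (inj₂ (inj₂ refl)))  = inj₁ (solve ρ (x₀ ⊝ x₀) ⊘ refl)

    open Subgroup pattern-sub using (pattern-neg; translate-∈; offset∈Pattern)

    Representation : Fin v → Fin v → Set
    Representation c′ q = CyclicQ₁ q × Shape ≡ shape₁ c′ q

    Choice : Fin v → Fin v → Set
    Choice c′ q = c′ ∈ Shape × ((q + c′ ∈ Shape × q ≢ 0#) × q ≢ h₀)

    representation⇒choice : ∀ {c′ q} → Representation c′ q → Choice c′ q
    representation⇒choice (2q≡h₀ , X≡) =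
      subst (_ ∈_) (sym X≡) set4∋₁ , ((subst (_ ∈_) (sym X≡) set4∋₂ , ¬Ω₁⇒≢0# ¬Ωq) , ¬Ω₁⇒≢ ¬Ωq Ωh₀)
      where ¬Ωq = cyclicQ₁⇒¬Ω₁ 2q≡h₀

    choice⇒representation : ∀ {c′ q} → Choice c′ q → Representation c′ q
    choice⇒representation {c′} {q} (c′∈ , ((q+c′∈ , q≢0) , q≢h₀)) =
      cyclic (offset∈Pattern c′∈ q+c′∈) ,
      sym (set4≡ (¬Ω₁⇒distinct (cyclicQ₁⇒¬Ω₁ (cyclic Pq))) ∣Shape∣≡4 c′∈ q+c′∈
                 (translate-∈ c′∈ (pattern-neg Pq)) (translate-∈ c′∈ (inj₂ (inj₂ (inj₂ refl)))))
      where
      Pq = offset∈Pattern c′∈ q+c′∈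
      cyclic : Pattern q → CyclicQ₁ q
      cyclic (inj₁ q≡0)                = ⊥-elim (q≢0 q≡0)
      cyclic (inj₂ (inj₁ refl))        = 2a≡h₀
      cyclic (inj₂ (inj₂ (inj₁ refl))) = using-h₀≡2a (⊝ x₁ ⊕ ⊝ x₁) x₀ refl
      cyclic (inj₂ (inj₂ (inj₂ q≡h₀))) = ⊥-elim (q≢h₀ q≡h₀)

    fibre-size : ∑[ c′ < v ] ∑[ q < v ] 𝟙 (cyclicQ₁? q ×-dec (Shape ≟ˢ shape₁ c′ q)) ≡ 8
    fibre-size = begin
      ∑[ c′ < v ] ∑[ q < v ] 𝟙 (cyclicQ₁? q ×-dec (Shape ≟ˢ shape₁ c′ q))
        ≡⟨ sum-cong-≗ (λ c′ → sum-cong-≗ (λ q → 𝟙-cong _ (choice? c′ q) representation⇒choice choice⇒representation)) ⟩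
      ∑[ c′ < v ] ∑[ q < v ] 𝟙 (choice? c′ q)
        ≡⟨ ∑∑-𝟙× (_∈? Shape) (λ c′ q → (q + c′ ∈? Shape ×-dec q ≢? 0#) ×-dec q ≢? h₀) 2
                 (λ c′ c′∈ → count-offsets≢0,≢ ∣Shape∣≡4 c′∈ (translate-∈ c′∈ (inj₂ (inj₂ (inj₂ refl)))) h₀≢0) ⟩
      count (_∈? Shape) ℕ.* 2
        ≡⟨ cong (ℕ._* 2) (trans (sym (∣p∣≡count∈ Shape)) ∣Shape∣≡4) ⟩
      8
        ∎
      where
      open ≡-Reasoning
      choice? : ∀ c′ q → Dec (Choice c′ q)
      choice? c′ q = c′ ∈? Shape ×-dec ((q + c′ ∈? Shape ×-dec q ≢? 0#) ×-dec q ≢? h₀)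

module Q₂Sets {v : ℕ} (G : FinAbGroup v) (h₀ : Fin v) where

  open import Data.Nat.Base as ℕ using (ℕ)

  open FinAbGroup G
  open IsAbelianGroup isAbelianGroup using (assoc; identityʳ)
  open AbelianGroupSolver G
  open GroupLemmas G

  ParamQ₂ : Fin v → Fin v → Set
  ParamQ₂ h a = ¬ Ω₁ G a × Ω₁ G h × h ≢ 0# × h ≢ h₀ × a + a ≢ h

  paramQ₂? : ∀ h a → Dec (ParamQ₂ h a)
  paramQ₂? h a = ¬? (Ω₁? a) ×-dec Ω₁? h ×-dec h ≢? 0# ×-dec h ≢? h₀ ×-dec a + a ≢? h

  shape₂ : Fin v → Fin v → Fin v → Subset v
  shape₂ c h a = set4 G c (a + c) (h + c) ((h + a) + c)

  paramQ₂⇒distinct : ∀ {c h a} → ParamQ₂ h a → Distinct4 c (a + c) (h + c) ((h + a) + c)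
  paramQ₂⇒distinct {c} {h} {a} (¬Ωa , Ωh , h≢0 , _ , _) = record
    { p≢q = c≢z+c (¬Ω₁⇒≢0# ¬Ωa)
    ; p≢r = c≢z+c h≢0
    ; p≢s = c≢z+c (λ h+a≡0 → ¬Ωa (Ω₁-resp-≡ (sym (solve-from ρ (x₀ ⊕ x₁) ⊘ x₁ x₀ h+a≡0 refl)) Ωh))
    ; q≢r = z+c≢w+c (¬Ω₁⇒≢ ¬Ωa Ωh)
    ; q≢s = z+c≢w+c (λ a≡h+a → h≢0 (solve-from ρ x₁ (x₀ ⊕ x₁) x₀ ⊘ a≡h+a refl))
    ; r≢s = z+c≢w+c (λ h≡h+a → ¬Ω₁⇒≢0# ¬Ωa (solve-from ρ (x₀ ⊕ x₁) x₀ x₁ ⊘ (sym h≡h+a) refl))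
    }
    where ρ = (h , Ωh) ▶ a ▷ ε

  module Q₂Coset {c h a : Fin v} (ha : ParamQ₂ h a) where

    open Coset4 a h (h + a) c public

    private
      ¬Ωa  : ¬ Ω₁ G a
      ¬Ωa  = proj₁ ha
      Ωh   : Ω₁ G h
      Ωh   = proj₁ (proj₂ ha)
      h≢0  : h ≢ 0#
      h≢0  = proj₁ (proj₂ (proj₂ ha))
      h≢h₀ : h ≢ h₀
      h≢h₀ = proj₁ (proj₂ (proj₂ (proj₂ ha)))
      2a≢h : a + a ≢ h
      2a≢h = proj₂ (proj₂ (proj₂ (proj₂ ha)))
      ρ : Env 2
      ρ = (h , Ωh) ▶ a ▷ ε

    ∣Shape∣≡4 : ∣ Shape ∣ ≡ 4
    ∣Shape∣≡4 = ∣set4∣≡4 (paramQ₂⇒distinct ha)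

    pattern-h+ : ∀ {z} → Pattern z → Pattern (h + z)
    pattern-h+ (inj₁ refl)               = inj₂ (inj₂ (inj₁ (identityʳ h)))
    pattern-h+ (inj₂ (inj₁ refl))        = inj₂ (inj₂ (inj₂ refl))
    pattern-h+ (inj₂ (inj₂ (inj₁ refl))) = inj₁ Ωh
    pattern-h+ (inj₂ (inj₂ (inj₂ refl))) = inj₂ (inj₁ (solve ρ (x₀ ⊕ (x₀ ⊕ x₁)) x₁ refl))

    h+-∈ : ∀ {x} → x ∈ Shape → h + x ∈ Shape
    h+-∈ x∈ with ∈⁻ x∈
    ... | z , Pz , refl = subst (_∈ Shape) (assoc h z c) (∈⁺ (pattern-h+ Pz))

    Offset : Fin v → Set
    Offset w = w ≡ 0# ⊎ w ≡ h ⊎ w + w ≡ a + a ⊎ w + w ≡ - (a + a)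

    pattern-sub : ∀ {z w} → Pattern z → Pattern w → Offset (w + - z)
    pattern-sub (inj₁ refl) (inj₁ refl)                              = inj₁ (solve ρ (⊘ ⊝ ⊘) ⊘ refl)
    pattern-sub (inj₁ refl) (inj₂ (inj₁ refl))                       = inj₂ (inj₂ (inj₁ (solve ρ ((x₁ ⊝ ⊘) ⊕ (x₁ ⊝ ⊘)) (x₁ ⊕ x₁) refl)))
    pattern-sub (inj₁ refl) (inj₂ (inj₂ (inj₁ refl)))                = inj₂ (inj₁ (solve ρ (x₀ ⊝ ⊘) x₀ refl))
    pattern-sub (inj₁ refl) (inj₂ (inj₂ (inj₂ refl)))                = inj₂ (inj₂ (inj₁ (solve ρ (((x₀ ⊕ x₁) ⊝ ⊘) ⊕ ((x₀ ⊕ x₁) ⊝ ⊘)) (x₁ ⊕ x₁) refl)))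
    pattern-sub (inj₂ (inj₁ refl)) (inj₁ refl)                       = inj₂ (inj₂ (inj₂ (solve ρ ((⊘ ⊝ x₁) ⊕ (⊘ ⊝ x₁)) (⊝ (x₁ ⊕ x₁)) refl)))
    pattern-sub (inj₂ (inj₁ refl)) (inj₂ (inj₁ refl))                = inj₁ (solve ρ (x₁ ⊝ x₁) ⊘ refl)
    pattern-sub (inj₂ (inj₁ refl)) (inj₂ (inj₂ (inj₁ refl)))         = inj₂ (inj₂ (inj₂ (solve ρ ((x₀ ⊝ x₁) ⊕ (x₀ ⊝ x₁)) (⊝ (x₁ ⊕ x₁)) refl)))
    pattern-sub (inj₂ (inj₁ refl)) (inj₂ (inj₂ (inj₂ refl)))         = inj₂ (inj₁ (solve ρ ((x₀ ⊕ x₁) ⊝ x₁) x₀ refl))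
    pattern-sub (inj₂ (inj₂ (inj₁ refl))) (inj₁ refl)                = inj₂ (inj₁ (solve ρ (⊘ ⊝ x₀) x₀ refl))
    pattern-sub (inj₂ (inj₂ (inj₁ refl))) (inj₂ (inj₁ refl))         = inj₂ (inj₂ (inj₁ (solve ρ ((x₁ ⊝ x₀) ⊕ (x₁ ⊝ x₀)) (x₁ ⊕ x₁) refl)))
    pattern-sub (inj₂ (inj₂ (inj₁ refl))) (inj₂ (inj₂ (inj₁ refl)))  = inj₁ (solve ρ (x₀ ⊝ x₀) ⊘ refl)
    pattern-sub (inj₂ (inj₂ (inj₁ refl))) (inj₂ (inj₂ (inj₂ refl)))  = inj₂ (inj₂ (inj₁ (solve ρ (((x₀ ⊕ x₁) ⊝ x₀) ⊕ ((x₀ ⊕ x₁) ⊝ x₀)) (x₁ ⊕ x₁) refl)))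
    pattern-sub (inj₂ (inj₂ (inj₂ refl))) (inj₁ refl)                = inj₂ (inj₂ (inj₂ (solve ρ ((⊘ ⊝ (x₀ ⊕ x₁)) ⊕ (⊘ ⊝ (x₀ ⊕ x₁))) (⊝ (x₁ ⊕ x₁)) refl)))
    pattern-sub (inj₂ (inj₂ (inj₂ refl))) (inj₂ (inj₁ refl))         = inj₂ (inj₁ (solve ρ (x₁ ⊝ (x₀ ⊕ x₁)) x₀ refl))
    pattern-sub (inj₂ (inj₂ (inj₂ refl))) (inj₂ (inj₂ (inj₁ refl)))  = inj₂ (inj₂ (inj₂ (solve ρ ((x₀ ⊝ (x₀ ⊕ x₁)) ⊕ (x₀ ⊝ (x₀ ⊕ x₁))) (⊝ (x₁ ⊕ x₁)) refl)))
    pattern-sub (inj₂ (inj₂ (inj₂ refl))) (inj₂ (inj₂ (inj₂ refl)))  = inj₁ (solve ρ ((x₀ ⊕ x₁) ⊝ (x₀ ⊕ x₁)) ⊘ refl)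

    offset : ∀ {x w} → x ∈ Shape → w + x ∈ Shape → Offset w
    offset x∈ w+x∈ with offset-as-difference x∈ w+x∈
    ... | _ , _ , Pz , Pz′ , z′-z≡w = subst Offset z′-z≡w (pattern-sub Pz Pz′)

    private
      -w≡0⇒w≡0 : ∀ {w} → - w ≡ 0# → w ≡ 0#
      -w≡0⇒w≡0 {w} -w≡0 = solve-from (w ▷ ε) ⊘ (⊝ x₀) x₀ ⊘ (sym -w≡0) refl

      -w≡h⇒w≡h : ∀ {w} → - w ≡ h → w ≡ h
      -w≡h⇒w≡h {w} -w≡h = solve-from ((h , Ωh) ▶ w ▷ ε) x₀ (⊝ x₁) x₁ x₀ (sym -w≡h) refl

    Ω₁-offset≡h : ∀ {x w} → x ∈ Shape → w + x ∈ Shape → Ω₁ G w → w ≢ 0# → w ≡ h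
    Ω₁-offset≡h x∈ w+x∈ Ωw w≢0 with offset x∈ w+x∈
    ... | inj₁ w≡0                = ⊥-elim (w≢0 w≡0)
    ... | inj₂ (inj₁ w≡h)         = w≡h
    ... | inj₂ (inj₂ (inj₁ 2w≡2a)) = ⊥-elim (¬Ωa (trans (sym 2w≡2a) Ωw))
    ... | inj₂ (inj₂ (inj₂ 2w≡-2a)) = ⊥-elim (¬Ωa (-w≡0⇒w≡0 (trans (sym 2w≡-2a) Ωw)))

    offset-generic : ∀ {x w} → x ∈ Shape → w + x ∈ Shape → w ≢ 0# → w ≢ h → ¬ Ω₁ G w × w + w ≢ h
    offset-generic x∈ w+x∈ w≢0 w≢h with offset x∈ w+x∈
    ... | inj₁ w≡0                 = ⊥-elim (w≢0 w≡0)
    ... | inj₂ (inj₁ w≡h)          = ⊥-elim (w≢h w≡h)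
    ... | inj₂ (inj₂ (inj₁ 2w≡2a)) = (λ Ωw → ¬Ωa (trans (sym 2w≡2a) Ωw)) , (λ 2w≡h → 2a≢h (trans (sym 2w≡2a) 2w≡h))
    ... | inj₂ (inj₂ (inj₂ 2w≡-2a)) = (λ Ωw → ¬Ωa (-w≡0⇒w≡0 (trans (sym 2w≡-2a) Ωw))) ,
                                      (λ 2w≡h → 2a≢h (-w≡h⇒w≡h (trans (sym 2w≡-2a) 2w≡h)))

    Representation : Fin v → Fin v → Fin v → Set
    Representation c′ p q = ParamQ₂ p q × Shape ≡ shape₂ c′ p q

    Choice : Fin v → Fin v → Fin v → Set
    Choice c′ p q = c′ ∈ Shape × (p ≡ h × ((q + c′ ∈ Shape × q ≢ 0#) × q ≢ h))

    representation⇒choice : ∀ {c′ p q} → Representation c′ p q → Choice c′ p q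
    representation⇒choice ((¬Ωq , Ωp , p≢0 , _ , _) , X≡) =
      c′∈ , Ω₁-offset≡h c′∈ (subst (_ ∈_) (sym X≡) set4∋₃) Ωp p≢0 ,
      ((subst (_ ∈_) (sym X≡) set4∋₂ , ¬Ω₁⇒≢0# ¬Ωq) , ¬Ω₁⇒≢ ¬Ωq Ωh)
      where c′∈ = subst (_ ∈_) (sym X≡) set4∋₁

    choice⇒representation : ∀ {c′ p q} → Choice c′ p q → Representation c′ p q
    choice⇒representation {c′} {q = q} (c′∈ , refl , ((q+c′∈ , q≢0) , q≢h)) =
      hq , sym (set4≡ (paramQ₂⇒distinct hq) ∣Shape∣≡4 c′∈ q+c′∈ (h+-∈ c′∈)
                      (subst (_∈ Shape) (sym (assoc h q c′)) (h+-∈ q+c′∈)))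
      where
      generic = offset-generic c′∈ q+c′∈ q≢0 q≢h
      hq : ParamQ₂ h q
      hq = proj₁ generic , Ωh , h≢0 , h≢h₀ , proj₂ generic

    fibre-size : ∑[ c′ < v ] ∑[ p < v ] ∑[ q < v ] 𝟙 (paramQ₂? p q ×-dec (Shape ≟ˢ shape₂ c′ p q)) ≡ 8
    fibre-size = begin
      ∑[ c′ < v ] ∑[ p < v ] ∑[ q < v ] 𝟙 (paramQ₂? p q ×-dec (Shape ≟ˢ shape₂ c′ p q))
        ≡⟨ sum-cong-≗ (λ c′ → sum-cong-≗ (λ p → sum-cong-≗ (λ q → 𝟙-cong _ (choice? c′ p q) representation⇒choice choice⇒representation))) ⟩
      ∑[ c′ < v ] ∑[ p < v ] ∑[ q < v ] 𝟙 (choice? c′ p q)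
        ≡⟨ ∑∑∑-𝟙× (_∈? Shape) (λ _ p → p ≟ h) (λ c′ _ q → (q + c′ ∈? Shape ×-dec q ≢? 0#) ×-dec q ≢? h) 1 2
                  (λ _ _ → ∑-𝟙≡ h) (λ c′ _ c′∈ _ → count-offsets≢0,≢ ∣Shape∣≡4 c′∈ (h+-∈ c′∈) h≢0) ⟩
      count (_∈? Shape) ℕ.* 2
        ≡⟨ cong (ℕ._* 2) (trans (sym (∣p∣≡count∈ Shape)) ∣Shape∣≡4) ⟩
      8
        ∎
      where
      open ≡-Reasoning
      choice? : ∀ c′ p q → Dec (Choice c′ p q)
      choice? c′ p q = c′ ∈? Shape ×-dec (p ≟ h ×-dec ((q + c′ ∈? Shape ×-dec q ≢? 0#) ×-dec q ≢? h))

module KleinCosets {v : ℕ} (G : FinAbGroup v) where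

  open import Data.Nat.Base as ℕ using (ℕ)

  open FinAbGroup G
  open AbelianGroupSolver G
  open GroupLemmas G

  KleinPair : Fin v → Fin v → Set
  KleinPair h k = Ω₁ G h × Ω₁ G k × h ≢ 0# × k ≢ 0# × h ≢ k

  kleinPair? : ∀ h k → Dec (KleinPair h k)
  kleinPair? h k = Ω₁? h ×-dec Ω₁? k ×-dec h ≢? 0# ×-dec k ≢? 0# ×-dec h ≢? k

  shape₃ : Fin v → Fin v → Fin v → Subset v
  shape₃ c h k = set4 G c (h + c) (k + c) ((h + k) + c)

  kleinPair⇒distinct : ∀ {c h k} → KleinPair h k → Distinct4 c (h + c) (k + c) ((h + k) + c)
  kleinPair⇒distinct {c} {h} {k} (Ωh , Ωk , h≢0 , k≢0 , h≢k) = record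
    { p≢q = c≢z+c h≢0
    ; p≢r = c≢z+c k≢0
    ; p≢s = c≢z+c (λ h+k≡0 → h≢k (solve-from ρ (x₀ ⊕ x₁) ⊘ x₀ x₁ h+k≡0 refl))
    ; q≢r = z+c≢w+c h≢k
    ; q≢s = z+c≢w+c (λ h≡h+k → k≢0 (solve-from ρ x₀ (x₀ ⊕ x₁) x₁ ⊘ h≡h+k refl))
    ; r≢s = z+c≢w+c (λ k≡h+k → h≢0 (solve-from ρ x₁ (x₀ ⊕ x₁) x₀ ⊘ k≡h+k refl))
    }
    where ρ = (h , Ωh) ▶ (k , Ωk) ▶ ε

  module KleinCoset {c h k : Fin v} (hk : KleinPair h k) where

    open Coset4 h k (h + k) c public

    private
      Ωh : Ω₁ G h
      Ωh = proj₁ hk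
      Ωk : Ω₁ G k
      Ωk = proj₁ (proj₂ hk)
      ρ : Env 2
      ρ = (h , Ωh) ▶ (k , Ωk) ▶ ε

    pattern⊆Ω₁ : ∀ {z} → Pattern z → Ω₁ G z
    pattern⊆Ω₁ (inj₁ refl)               = Ω₁-0#
    pattern⊆Ω₁ (inj₂ (inj₁ refl))        = Ωh
    pattern⊆Ω₁ (inj₂ (inj₂ (inj₁ refl))) = Ωk
    pattern⊆Ω₁ (inj₂ (inj₂ (inj₂ refl))) = solve ρ ((x₀ ⊕ x₁) ⊕ (x₀ ⊕ x₁)) ⊘ refl

    pattern-sub : ∀ {z w} → Pattern z → Pattern w → Pattern (w + - z)
    pattern-sub (inj₁ refl) (inj₁ refl)                              = inj₁ (solve ρ (⊘ ⊝ ⊘) ⊘ refl)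
    pattern-sub (inj₁ refl) (inj₂ (inj₁ refl))                       = inj₂ (inj₁ (solve ρ (x₀ ⊝ ⊘) x₀ refl))
    pattern-sub (inj₁ refl) (inj₂ (inj₂ (inj₁ refl)))                = inj₂ (inj₂ (inj₁ (solve ρ (x₁ ⊝ ⊘) x₁ refl)))
    pattern-sub (inj₁ refl) (inj₂ (inj₂ (inj₂ refl)))                = inj₂ (inj₂ (inj₂ (solve ρ ((x₀ ⊕ x₁) ⊝ ⊘) (x₀ ⊕ x₁) refl)))
    pattern-sub (inj₂ (inj₁ refl)) (inj₁ refl)                       = inj₂ (inj₁ (solve ρ (⊘ ⊝ x₀) x₀ refl))
    pattern-sub (inj₂ (inj₁ refl)) (inj₂ (inj₁ refl))                = inj₁ (solve ρ (x₀ ⊝ x₀) ⊘ refl)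
    pattern-sub (inj₂ (inj₁ refl)) (inj₂ (inj₂ (inj₁ refl)))         = inj₂ (inj₂ (inj₂ (solve ρ (x₁ ⊝ x₀) (x₀ ⊕ x₁) refl)))
    pattern-sub (inj₂ (inj₁ refl)) (inj₂ (inj₂ (inj₂ refl)))         = inj₂ (inj₂ (inj₁ (solve ρ ((x₀ ⊕ x₁) ⊝ x₀) x₁ refl)))
    pattern-sub (inj₂ (inj₂ (inj₁ refl))) (inj₁ refl)                = inj₂ (inj₂ (inj₁ (solve ρ (⊘ ⊝ x₁) x₁ refl)))
    pattern-sub (inj₂ (inj₂ (inj₁ refl))) (inj₂ (inj₁ refl))         = inj₂ (inj₂ (inj₂ (solve ρ (x₀ ⊝ x₁) (x₀ ⊕ x₁) refl)))
    pattern-sub (inj₂ (inj₂ (inj₁ refl))) (inj₂ (inj₂ (inj₁ refl)))  = inj₁ (solve ρ (x₁ ⊝ x₁) ⊘ refl)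
    pattern-sub (inj₂ (inj₂ (inj₁ refl))) (inj₂ (inj₂ (inj₂ refl)))  = inj₂ (inj₁ (solve ρ ((x₀ ⊕ x₁) ⊝ x₁) x₀ refl))
    pattern-sub (inj₂ (inj₂ (inj₂ refl))) (inj₁ refl)                = inj₂ (inj₂ (inj₂ (solve ρ (⊘ ⊝ (x₀ ⊕ x₁)) (x₀ ⊕ x₁) refl)))
    pattern-sub (inj₂ (inj₂ (inj₂ refl))) (inj₂ (inj₁ refl))         = inj₂ (inj₂ (inj₁ (solve ρ (x₀ ⊝ (x₀ ⊕ x₁)) x₁ refl)))
    pattern-sub (inj₂ (inj₂ (inj₂ refl))) (inj₂ (inj₂ (inj₁ refl)))  = inj₂ (inj₁ (solve ρ (x₁ ⊝ (x₀ ⊕ x₁)) x₀ refl))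
    pattern-sub (inj₂ (inj₂ (inj₂ refl))) (inj₂ (inj₂ (inj₂ refl)))  = inj₁ (solve ρ ((x₀ ⊕ x₁) ⊝ (x₀ ⊕ x₁)) ⊘ refl)

    open Subgroup pattern-sub public using (pattern-+; translate-∈; offset∈Pattern)

    ∣Shape∣≡4 : ∣ Shape ∣ ≡ 4
    ∣Shape∣≡4 = ∣set4∣≡4 (kleinPair⇒distinct hk)

    Representation : Fin v → Fin v → Fin v → Set
    Representation c′ p q = KleinPair p q × Shape ≡ shape₃ c′ p q

    Choice : Fin v → Fin v → Fin v → Set
    Choice c′ p q = c′ ∈ Shape × (p + c′ ∈ Shape × p ≢ 0#) × ((q + c′ ∈ Shape × q ≢ 0#) × q ≢ p)

    representation⇒choice : ∀ {c′ p q} → Representation c′ p q → Choice c′ p q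
    representation⇒choice ((_ , _ , p≢0 , q≢0 , p≢q) , X≡) =
      subst (_ ∈_) (sym X≡) set4∋₁ , (subst (_ ∈_) (sym X≡) set4∋₂ , p≢0) , ((subst (_ ∈_) (sym X≡) set4∋₃ , q≢0) , p≢q ∘ sym)

    choice⇒representation : ∀ {c′ p q} → Choice c′ p q → Representation c′ p q
    choice⇒representation {c′} {p} {q} (c′∈ , (p+c′∈ , p≢0) , ((q+c′∈ , q≢0) , q≢p)) =
      pq , sym (set4≡ (kleinPair⇒distinct pq) ∣Shape∣≡4 c′∈ p+c′∈ q+c′∈ p+q+c′∈)
      where
      Pp = offset∈Pattern c′∈ p+c′∈
      Pq = offset∈Pattern c′∈ q+c′∈
      pq : KleinPair p q
      pq = pattern⊆Ω₁ Pp , pattern⊆Ω₁ Pq , p≢0 , q≢0 , q≢p ∘ sym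
      p+q+c′∈ : (p + q) + c′ ∈ Shape
      p+q+c′∈ = translate-∈ c′∈ (pattern-+ Pp Pq)

    fibre-size : ∑[ c′ < v ] ∑[ p < v ] ∑[ q < v ] 𝟙 (kleinPair? p q ×-dec (Shape ≟ˢ shape₃ c′ p q)) ≡ 24
    fibre-size = begin
      ∑[ c′ < v ] ∑[ p < v ] ∑[ q < v ] 𝟙 (kleinPair? p q ×-dec (Shape ≟ˢ shape₃ c′ p q))
        ≡⟨ sum-cong-≗ (λ c′ → sum-cong-≗ (λ p → sum-cong-≗ (λ q → 𝟙-cong _ (choice? c′ p q) representation⇒choice choice⇒representation))) ⟩
      ∑[ c′ < v ] ∑[ p < v ] ∑[ q < v ] 𝟙 (choice? c′ p q)
        ≡⟨ ∑∑∑-𝟙× (_∈? Shape) (λ c′ p → p + c′ ∈? Shape ×-dec p ≢? 0#) (λ c′ p q → (q + c′ ∈? Shape ×-dec q ≢? 0#) ×-dec q ≢? p) 3 2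
                  (λ c′ c′∈ → count-offsets≢0 ∣Shape∣≡4 c′∈) (λ c′ p c′∈ (p+c′∈ , p≢0) → count-offsets≢0,≢ ∣Shape∣≡4 c′∈ p+c′∈ p≢0) ⟩
      count (_∈? Shape) ℕ.* 6
        ≡⟨ cong (ℕ._* 6) (trans (sym (∣p∣≡count∈ Shape)) ∣Shape∣≡4) ⟩
      24
        ∎
      where
      open ≡-Reasoning
      choice? : ∀ c′ p q → Dec (Choice c′ p q)
      choice? c′ p q = c′ ∈? Shape ×-dec (p + c′ ∈? Shape ×-dec p ≢? 0#) ×-dec ((q + c′ ∈? Shape ×-dec q ≢? 0#) ×-dec q ≢? p)

module ParameterCounts {v : ℕ} (G : FinAbGroup v) {h₀ : Fin v} (h₀≢0 : h₀ ≢ FinAbGroup.0# G) (Ωh₀ : Ω₁ G h₀) where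

  open import Data.List.Base using (allFin)
  open import Data.Nat.Base as ℕ using (ℕ; _+_; _*_)
  open import Data.Nat.Properties using (*-identityʳ; *-comm; *-distribˡ-+; +-assoc; +-cancelʳ-≡)

  open FinAbGroup G renaming (_+_ to _⊕_)
  open IsAbelianGroup isAbelianGroup using (assoc)
  open GroupLemmas G
  open Q₁Sets G h₀≢0 Ωh₀
  open Q₂Sets G h₀
  open KleinCosets G

  halves : Fin v → ℕ
  halves h = count (λ a → a ⊕ a ≟ h)

  ω₁≡halves0 : ω₁ G ≡ halves 0#
  ω₁≡halves0 = trans (length-filter (λ a → a ⊕ a ≟ 0#) (allFin v)) (∑ˡ-tabulate v (λ i → i) _)

  ω₂≡count : ω₂ G ≡ count (λ a → a ⊕ a ⊕ a ⊕ a ≟ 0#)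
  ω₂≡count = trans (length-filter (λ a → a ⊕ a ⊕ a ⊕ a ≟ 0#) (allFin v)) (∑ˡ-tabulate v (λ i → i) _)

  GenericFor : Fin v → Fin v → Set
  GenericFor h a = ¬ Ω₁ G a × a ⊕ a ≢ h

  genericFor? : ∀ h a → Dec (GenericFor h a)
  genericFor? h a = ¬? (Ω₁? a) ×-dec a ⊕ a ≢? h

  count-genericFor : ∀ h → h ≢ 0# → count (genericFor? h) + halves 0# + halves h ≡ v
  count-genericFor h h≢0 = begin
    count (genericFor? h) + halves 0# + halves h                           ≡⟨ cong (_+ halves h) (∑-distrib-+ (λ a → 𝟙 (genericFor? h a)) _) ⟨
    ∑[ a < v ] (𝟙 (genericFor? h a) + 𝟙 (a ⊕ a ≟ 0#)) + halves h           ≡⟨ ∑-distrib-+ (λ a → 𝟙 (genericFor? h a) + 𝟙 (a ⊕ a ≟ 0#)) _ ⟨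
    ∑[ a < v ] (𝟙 (genericFor? h a) + 𝟙 (a ⊕ a ≟ 0#) + 𝟙 (a ⊕ a ≟ h))     ≡⟨ sum-cong-≗ {v} (λ a → exactly-one (Ω₁? a) (a ⊕ a ≟ h)) ⟩
    ∑[ a < v ] 1                                                           ≡⟨ ∑-const v 1 ⟩
    v * 1                                                                  ≡⟨ *-identityʳ v ⟩
    v                                                                      ∎
    where
    open ≡-Reasoning
    exactly-one : ∀ {a} (P? : Dec (a ⊕ a ≡ 0#)) (Q? : Dec (a ⊕ a ≡ h)) → 𝟙 (¬? P? ×-dec ¬? Q?) + 𝟙 P? + 𝟙 Q? ≡ 1
    exactly-one (yes 2a≡0) (yes 2a≡h) = ⊥-elim (h≢0 (trans (sym 2a≡h) 2a≡0))
    exactly-one (yes _)    (no _)     = refl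
    exactly-one (no _)     (yes _)    = refl
    exactly-one (no _)     (no _)     = refl

  NonzeroΩ₁ : Fin v → Set
  NonzeroΩ₁ h = Ω₁ G h × h ≢ 0#

  nonzeroΩ₁? : ∀ h → Dec (NonzeroΩ₁ h)
  nonzeroΩ₁? h = Ω₁? h ×-dec h ≢? 0#

  count-nonzeroΩ₁ : count nonzeroΩ₁? + 1 ≡ halves 0#
  count-nonzeroΩ₁ = count-remove Ω₁? Ω₁-0#

  Other : Fin v → Fin v → Set
  Other h k = NonzeroΩ₁ k × k ≢ h

  other? : ∀ h k → Dec (Other h k)
  other? h k = nonzeroΩ₁? k ×-dec k ≢? h

  count-other : ∀ {h} → NonzeroΩ₁ h → count (other? h) + 1 ≡ count nonzeroΩ₁?
  count-other Hh = count-remove nonzeroΩ₁? Hh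

  ∑∑-kleinPair : ∑[ h < v ] ∑[ k < v ] 𝟙 (kleinPair? h k) ≡ count nonzeroΩ₁? * count (other? h₀)
  ∑∑-kleinPair = trans (sum-cong-≗ {v} (λ h → sum-cong-≗ {v} (λ k →
      𝟙-cong (kleinPair? h k) (nonzeroΩ₁? h ×-dec other? h k)
        (λ (Ωh , Ωk , h≢0 , k≢0 , h≢k) → (Ωh , h≢0) , ((Ωk , k≢0) , h≢k ∘ sym))
        (λ ((Ωh , h≢0) , ((Ωk , k≢0) , k≢h)) → Ωh , Ωk , h≢0 , k≢0 , k≢h ∘ sym))))
    (∑∑-𝟙× nonzeroΩ₁? other? (count (other? h₀))
      (λ h Hh → +-cancelʳ-≡ 1 _ _ (trans (count-other Hh) (sym (count-other (Ωh₀ , h₀≢0))))))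

  ∑∑-paramQ₂ : ∑[ h < v ] ∑[ a < v ] 𝟙 (paramQ₂? h a) + (count (other? h₀) * halves 0# + ∑[ h < v ] (𝟙 (other? h₀ h) * halves h))
               ≡ count (other? h₀) * v
  ∑∑-paramQ₂ = begin
    ∑[ h < v ] ∑[ a < v ] 𝟙 (paramQ₂? h a) + (count (other? h₀) * halves 0# + ∑[ h < v ] (𝟙 (other? h₀ h) * halves h))
      ≡⟨ cong₂ _+_ (sum-cong-≗ {v} split) (cong (_+ ∑[ h < v ] (𝟙 (other? h₀ h) * halves h)) (*-distribʳ-sum (halves 0#) (λ h → 𝟙 (other? h₀ h)))) ⟩
    ∑[ h < v ] (𝟙 (other? h₀ h) * count (genericFor? h)) + (∑[ h < v ] (𝟙 (other? h₀ h) * halves 0#) + ∑[ h < v ] (𝟙 (other? h₀ h) * halves h))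
      ≡⟨ cong (∑[ h < v ] (𝟙 (other? h₀ h) * count (genericFor? h)) +_) (∑-distrib-+ (λ h → 𝟙 (other? h₀ h) * halves 0#) _) ⟨
    ∑[ h < v ] (𝟙 (other? h₀ h) * count (genericFor? h)) + ∑[ h < v ] (𝟙 (other? h₀ h) * halves 0# + 𝟙 (other? h₀ h) * halves h)
      ≡⟨ ∑-distrib-+ (λ h → 𝟙 (other? h₀ h) * count (genericFor? h)) _ ⟨
    ∑[ h < v ] (𝟙 (other? h₀ h) * count (genericFor? h) + (𝟙 (other? h₀ h) * halves 0# + 𝟙 (other? h₀ h) * halves h))
      ≡⟨ sum-cong-≗ {v} (λ h → factor (𝟙 (other? h₀ h)) (count (genericFor? h)) (halves 0#) (halves h)) ⟩
    ∑[ h < v ] (𝟙 (other? h₀ h) * (count (genericFor? h) + halves 0# + halves h))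
      ≡⟨ ∑-𝟙*-const (other? h₀) _ v (λ h (((_ , h≢0)) , _) → count-genericFor h h≢0) ⟩
    count (other? h₀) * v
      ∎
    where
    open ≡-Reasoning
    split : ∀ h → ∑[ a < v ] 𝟙 (paramQ₂? h a) ≡ 𝟙 (other? h₀ h) * count (genericFor? h)
    split h = trans (sum-cong-≗ {v} (λ a → trans
        (𝟙-cong (paramQ₂? h a) (other? h₀ h ×-dec genericFor? h a)
          (λ (¬Ωa , Ωh , h≢0 , h≢h₀ , 2a≢h) → ((Ωh , h≢0) , h≢h₀) , (¬Ωa , 2a≢h))
          (λ (((Ωh , h≢0) , h≢h₀) , (¬Ωa , 2a≢h)) → ¬Ωa , Ωh , h≢0 , h≢h₀ , 2a≢h))
        (𝟙-× (other? h₀ h) (genericFor? h a))))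
      (sym (*-distribˡ-sum (𝟙 (other? h₀ h)) (λ a → 𝟙 (genericFor? h a))))
    factor : ∀ i m x y → i * m + (i * x + i * y) ≡ i * (m + x + y)
    factor i m x y = trans (cong (i * m +_) (sym (*-distribˡ-+ i x y)))
                           (trans (sym (*-distribˡ-+ i m (x + y))) (cong (i *_) (sym (+-assoc m x y))))

  ∑-Ω₁*halves : ∑[ h < v ] (𝟙 (Ω₁? h) * halves h) ≡ count (λ a → a ⊕ a ⊕ a ⊕ a ≟ 0#)
  ∑-Ω₁*halves = begin
    ∑[ h < v ] (𝟙 (Ω₁? h) * ∑[ a < v ] 𝟙 (a ⊕ a ≟ h))           ≡⟨ sum-cong-≗ {v} (λ h → *-distribˡ-sum (𝟙 (Ω₁? h)) (λ a → 𝟙 (a ⊕ a ≟ h))) ⟩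
    ∑[ h < v ] ∑[ a < v ] (𝟙 (Ω₁? h) * 𝟙 (a ⊕ a ≟ h))          ≡⟨ ∑-comm (λ h a → 𝟙 (Ω₁? h) * 𝟙 (a ⊕ a ≟ h)) ⟩
    ∑[ a < v ] ∑[ h < v ] (𝟙 (Ω₁? h) * 𝟙 (a ⊕ a ≟ h))          ≡⟨ sum-cong-≗ {v} (λ a → sum-cong-≗ {v} (λ h →
                                                                  trans (*-comm (𝟙 (Ω₁? h)) _) (cong (_* 𝟙 (Ω₁? h)) (𝟙-cong (a ⊕ a ≟ h) (h ≟ a ⊕ a) sym sym)))) ⟩
    ∑[ a < v ] ∑[ h < v ] (𝟙 (h ≟ a ⊕ a) * 𝟙 (Ω₁? h))          ≡⟨ sum-cong-≗ {v} (λ a → ∑-𝟙≡* (a ⊕ a) (λ h → 𝟙 (Ω₁? h))) ⟩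
    ∑[ a < v ] 𝟙 (Ω₁? (a ⊕ a))                                 ≡⟨ sum-cong-≗ {v} (λ a → 𝟙-cong (Ω₁? (a ⊕ a)) (a ⊕ a ⊕ a ⊕ a ≟ 0#)
                                                                  (trans (assoc (a ⊕ a) a a)) (trans (sym (assoc (a ⊕ a) a a)))) ⟩
    count (λ a → a ⊕ a ⊕ a ⊕ a ≟ 0#)                           ∎
    where open ≡-Reasoning

  ∑-other*halves : ∑[ h < v ] (𝟙 (other? h₀ h) * halves h) + halves h₀ + halves 0# ≡ count (λ a → a ⊕ a ⊕ a ⊕ a ≟ 0#)
  ∑-other*halves = begin
    ∑[ h < v ] (𝟙 (other? h₀ h) * halves h) + halves h₀ + halves 0#  ≡⟨ cong (_+ halves 0#) (∑-𝟙*-remove nonzeroΩ₁? (Ωh₀ , h₀≢0) halves) ⟩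
    ∑[ h < v ] (𝟙 (nonzeroΩ₁? h) * halves h) + halves 0#              ≡⟨ ∑-𝟙*-remove Ω₁? Ω₁-0# halves ⟩
    ∑[ h < v ] (𝟙 (Ω₁? h) * halves h)                                 ≡⟨ ∑-Ω₁*halves ⟩
    count (λ a → a ⊕ a ⊕ a ⊕ a ≟ 0#)                                  ∎
    where open ≡-Reasoning

module CountingIdentity where

  open import Data.Integer.Base using (ℤ; +_; _+_; _-_; _*_)
  import Data.Integer.Properties as ℤ
  open import Data.Integer.Tactic.RingSolver using (solve-∀)
  open import Data.Nat.Base as ℕ using (ℕ)

  private
    x+y≡z⇒x≡z-y : ∀ {x y z : ℤ} → x + y ≡ z → x ≡ z - y
    x+y≡z⇒x≡z-y {x} {y} refl = lemma x y
      where
      lemma : ∀ x y → x ≡ x + y - y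
      lemma = solve-∀

    -- The unknowns n₁, T, nH, S, nI are eliminated by matching their solved forms with refl.
    polynomial-identity : ∀ (A B C D v n₁ e T nH S nI w₁ w₂ : ℤ) →
      n₁ ≡ v - e - w₁ → T ≡ nH * v - (nH * w₁ + S) → nH ≡ nI - + 1 → nI ≡ w₁ - + 1 → S ≡ w₂ - w₁ - e →
      A * + 4 ≡ v * n₁ → B * + 8 ≡ v * e → C * + 8 ≡ v * T → D * + 24 ≡ v * (nI * nH) →
      + 24 * (A + (B + (C + D))) ≡ + 3 * v * v * w₁ - v * (+ 2 * w₁ * w₁ + + 3 * w₂ - + 2)
    polynomial-identity A B C D v _ e _ _ _ _ w₁ w₂ refl refl refl refl refl 4A≡ 8B≡ 8C≡ 24D≡ = begin
      + 24 * (A + (B + (C + D)))                                      ≡⟨ regroup A B C D ⟩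
      + 6 * (A * + 4) + + 3 * (B * + 8) + + 3 * (C * + 8) + D * + 24  ≡⟨ cong₂ _+_ (cong₂ _+_ (cong₂ _+_ (cong (+ 6 *_) 4A≡) (cong (+ 3 *_) 8B≡)) (cong (+ 3 *_) 8C≡)) 24D≡ ⟩
      + 6 * (v * (v - e - w₁)) + + 3 * (v * e)
        + + 3 * (v * ((w₁ - + 1 - + 1) * v - ((w₁ - + 1 - + 1) * w₁ + (w₂ - w₁ - e))))
        + v * ((w₁ - + 1) * (w₁ - + 1 - + 1))                         ≡⟨ expand v e w₁ w₂ ⟩
      + 3 * v * v * w₁ - v * (+ 2 * w₁ * w₁ + + 3 * w₂ - + 2)         ∎
      where
      open ≡-Reasoning
      regroup : ∀ A B C D → + 24 * (A + (B + (C + D))) ≡ + 6 * (A * + 4) + + 3 * (B * + 8) + + 3 * (C * + 8) + D * + 24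
      regroup = solve-∀
      expand : ∀ v e w₁ w₂ →
        + 6 * (v * (v - e - w₁)) + + 3 * (v * e) + + 3 * (v * ((w₁ - + 1 - + 1) * v - ((w₁ - + 1 - + 1) * w₁ + (w₂ - w₁ - e))))
          + v * ((w₁ - + 1) * (w₁ - + 1 - + 1))
        ≡ + 3 * v * v * w₁ - v * (+ 2 * w₁ * w₁ + + 3 * w₂ - + 2)
      expand = solve-∀

    pos-*-≡ : ∀ {m n o p : ℕ} → m ℕ.* n ≡ o ℕ.* p → + m * + n ≡ + o * + p
    pos-*-≡ {m} {n} {o} {p} eq = trans (sym (ℤ.pos-* m n)) (trans (cong +_ eq) (ℤ.pos-* o p))

    solved₂ : ∀ {m n o : ℕ} → m ℕ.+ n ≡ o → + m ≡ + o - + n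
    solved₂ {m} {n} eq = x+y≡z⇒x≡z-y {y = + n} (trans (sym (ℤ.pos-+ m n)) (cong +_ eq))

    solved₃ : ∀ {m n o p : ℕ} → m ℕ.+ n ℕ.+ o ≡ p → + m ≡ + p - + o - + n
    solved₃ {m} {n} {o} eq = x+y≡z⇒x≡z-y {y = + n} (trans (sym (ℤ.pos-+ m n)) (solved₂ {m ℕ.+ n} {o} eq))

    solvedT : ∀ {t h w s u : ℕ} → t ℕ.+ (h ℕ.* w ℕ.+ s) ≡ h ℕ.* u → + t ≡ + h * + u - (+ h * + w + + s)
    solvedT {t} {h} {w} {s} {u} eq = x+y≡z⇒x≡z-y {y = + h * + w + + s} (begin
      + t + (+ h * + w + + s)    ≡⟨ cong (λ x → + t + (x + + s)) (ℤ.pos-* h w) ⟨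
      + t + (+ (h ℕ.* w) + + s)  ≡⟨ cong (_+_ (+ t)) (ℤ.pos-+ (h ℕ.* w) s) ⟨
      + t + + (h ℕ.* w ℕ.+ s)    ≡⟨ ℤ.pos-+ t _ ⟨
      + (t ℕ.+ (h ℕ.* w ℕ.+ s))  ≡⟨ cong +_ eq ⟩
      + (h ℕ.* u)                ≡⟨ ℤ.pos-* h u ⟩
      + h * + u                  ∎)
      where open ≡-Reasoning

  counting-identity : ∀ (A B C D v n₁ e T nH S nI w₁ w₂ : ℕ) →
    n₁ ℕ.+ w₁ ℕ.+ e ≡ v → T ℕ.+ (nH ℕ.* w₁ ℕ.+ S) ≡ nH ℕ.* v → nH ℕ.+ 1 ≡ nI → nI ℕ.+ 1 ≡ w₁ → S ℕ.+ e ℕ.+ w₁ ≡ w₂ →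
    A ℕ.* 4 ≡ v ℕ.* n₁ → B ℕ.* 8 ≡ v ℕ.* e → C ℕ.* 8 ≡ v ℕ.* T → D ℕ.* 24 ≡ v ℕ.* (nI ℕ.* nH) →
    + 24 * + (A ℕ.+ (B ℕ.+ (C ℕ.+ D))) ≡ + 3 * + v * + v * + w₁ - + v * (+ 2 * + w₁ * + w₁ + + 3 * + w₂ - + 2)
  counting-identity A B C D v n₁ e T nH S nI w₁ w₂ n₁≡ T≡ nH≡ nI≡ S≡ 4A≡ 8B≡ 8C≡ 24D≡ = begin
    + 24 * + (A ℕ.+ (B ℕ.+ (C ℕ.+ D)))        ≡⟨ cong (+ 24 *_) (trans (ℤ.pos-+ A _) (cong (_+_ (+ A)) (trans (ℤ.pos-+ B _) (cong (_+_ (+ B)) (ℤ.pos-+ C D))))) ⟩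
    + 24 * (+ A + (+ B + (+ C + + D)))        ≡⟨ polynomial-identity (+ A) (+ B) (+ C) (+ D) (+ v) (+ n₁) (+ e) (+ T) (+ nH) (+ S) (+ nI) (+ w₁) (+ w₂)
                                                   (solved₃ {n₁} {w₁} {e} n₁≡) (solvedT {T} {nH} {w₁} {S} {v} T≡) (solved₂ {nH} {1} nH≡)
                                                   (solved₂ {nI} {1} nI≡) (solved₃ {S} {e} {w₁} S≡)
                                                   (pos-*-≡ {A} {4} {v} {n₁} 4A≡) (pos-*-≡ {B} {8} {v} {e} 8B≡) (pos-*-≡ {C} {8} {v} {T} 8C≡)
                                                   (trans (pos-*-≡ {D} {24} {v} {nI ℕ.* nH} 24D≡) (cong (+ v *_) (ℤ.pos-* nI nH))) ⟩
    + 3 * + v * + v * + w₁ - + v * (+ 2 * + w₁ * + w₁ + + 3 * + w₂ - + 2) ∎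
    where open ≡-Reasoning

open CountingIdentity

module B₀Decomposition {v : ℕ} (G : FinAbGroup v) {h₀ : Fin v} (h₀≢0 : h₀ ≢ FinAbGroup.0# G) (Ωh₀ : Ω₁ G h₀) where

  open import Data.Integer.Base using (+_; _-_; _*_) renaming (_+_ to _+ℤ_)
  open import Data.List.Base using (List; length; filter)
  open import Data.List.Membership.Propositional.Properties using (∈-filter⁺; ∈-filter⁻)
  import Data.List.Relation.Unary.Unique.Propositional.Properties as Unique
  open import Data.Nat.Base as ℕ using (ℕ)
  open import Data.Product.Base using (uncurry)
  open import Function.Bundles using (mk⇔)
  open import Relation.Nullary.Decidable using (map′)

  open FinAbGroup G
  open AbelianGroupSolver G
  open GroupLemmas G
  open Q₁Sets G h₀≢0 Ωh₀
  open Q₂Sets G h₀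
  open KleinCosets G

  Pairs Triples : SummableType
  Pairs   = v ×ˢ finSummable v
  Triples = v ×ˢ v ×ˢ finSummable v

  module Pairs   = DoubleCounting Pairs
  module Triples = DoubleCounting Triples

  shape₂′ : Fin v × Fin v × Fin v → Subset v
  shape₂′ (c , h , a) = shape₂ c h a

  shape₃′ : Fin v × Fin v × Fin v → Subset v
  shape₃′ (c , h , k) = shape₃ c h k

  GenericQ₁Set CyclicQ₁Set Q₂Set Q₃Set : Subset v → Set
  GenericQ₁Set = Pairs.Represented (genericQ₁? ∘ proj₂) (uncurry shape₁)
  CyclicQ₁Set  = Pairs.Represented (cyclicQ₁? ∘ proj₂) (uncurry shape₁)
  Q₂Set        = Triples.Represented (uncurry paramQ₂? ∘ proj₂) shape₂′
  Q₃Set        = Triples.Represented (uncurry kleinPair? ∘ proj₂) shape₃′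

  InFamily : Subset v → Set
  InFamily X = GenericQ₁Set X ⊎ CyclicQ₁Set X ⊎ Q₂Set X ⊎ Q₃Set X

  genericQ₁Set? : ∀ X → Dec (GenericQ₁Set X)
  genericQ₁Set? = Pairs.represented? (genericQ₁? ∘ proj₂) (uncurry shape₁)
  cyclicQ₁Set? : ∀ X → Dec (CyclicQ₁Set X)
  cyclicQ₁Set?  = Pairs.represented? (cyclicQ₁? ∘ proj₂) (uncurry shape₁)
  q₂Set? : ∀ X → Dec (Q₂Set X)
  q₂Set?        = Triples.represented? (uncurry paramQ₂? ∘ proj₂) shape₂′
  q₃Set? : ∀ X → Dec (Q₃Set X)
  q₃Set?        = Triples.represented? (uncurry kleinPair? ∘ proj₂) shape₃′

  inFamily? : ∀ X → Dec (InFamily X)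
  inFamily? X = genericQ₁Set? X ⊎-dec cyclicQ₁Set? X ⊎-dec q₂Set? X ⊎-dec q₃Set? X

  Q₁⇒InFamily : ∀ {X c a} → ¬ Ω₁ G a → X ≡ shape₁ c a → InFamily X
  Q₁⇒InFamily {c = c} {a} ¬Ωa X≡ with cyclicQ₁? a
  ... | yes 2a≡h₀ = inj₂ (inj₁ ((c , a) , 2a≡h₀ , X≡))
  ... | no 2a≢h₀  = inj₁ ((c , a) , (¬Ωa , 2a≢h₀) , X≡)

  -- The reflected orbit -X + c of a shape is the shape for -a in place of a.
  InB₀⇒InFamily : ∀ {X} → InB₀ G h₀ X → InFamily X
  InB₀⇒InFamily (_ , inj₁ (a , ¬Ωa , c , inj₁ X≡)) = Q₁⇒InFamily ¬Ωa X≡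
  InB₀⇒InFamily (_ , inj₁ (a , ¬Ωa , c , inj₂ X≡)) =
    Q₁⇒InFamily (¬Ωa ∘ Ω₁-neg) (trans X≡ (set4-cong refl refl refl (cong (_+ c) (Ω₁⇒-≡ Ωh₀))))
  InB₀⇒InFamily (_ , inj₂ (inj₁ (a , h , ¬Ωa , Ωh , h≢0 , h≢h₀ , 2a≢h , c , inj₁ X≡))) =
    inj₂ (inj₂ (inj₁ ((c , h , a) , (¬Ωa , Ωh , h≢0 , h≢h₀ , 2a≢h) , X≡)))
  InB₀⇒InFamily (_ , inj₂ (inj₁ (a , h , ¬Ωa , Ωh , h≢0 , h≢h₀ , 2a≢h , c , inj₂ X≡))) =
    inj₂ (inj₂ (inj₁ ((c , h , - a) , (¬Ωa ∘ Ω₁-neg , Ωh , h≢0 , h≢h₀ , 2[-a]≢h) ,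
      trans X≡ (set4-cong refl refl (cong (_+ c) (Ω₁⇒-≡ Ωh)) (cong (_+ c) (solve ρ (⊝ (x₀ ⊕ x₁)) (x₀ ⊝ x₁) refl))))))
    where
    ρ = (h , Ωh) ▶ a ▷ ε
    2[-a]≢h : - a + - a ≢ h
    2[-a]≢h 2[-a]≡h = 2a≢h (solve-from ρ x₀ (⊝ x₁ ⊕ ⊝ x₁) (x₁ ⊕ x₁) x₀ (sym 2[-a]≡h) refl)
  InB₀⇒InFamily (_ , inj₂ (inj₂ (h , k , Ωh , Ωk , h≢0 , k≢0 , h≢k , c , inj₁ X≡))) =
    inj₂ (inj₂ (inj₂ ((c , h , k) , (Ωh , Ωk , h≢0 , k≢0 , h≢k) , X≡)))
  InB₀⇒InFamily (_ , inj₂ (inj₂ (h , k , Ωh , Ωk , h≢0 , k≢0 , h≢k , c , inj₂ X≡))) =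
    inj₂ (inj₂ (inj₂ ((c , h , k) , (Ωh , Ωk , h≢0 , k≢0 , h≢k) ,
      trans X≡ (set4-cong refl (cong (_+ c) (Ω₁⇒-≡ Ωh)) (cong (_+ c) (Ω₁⇒-≡ Ωk))
                          (cong (_+ c) (solve ((h , Ωh) ▶ (k , Ωk) ▶ ε) (⊝ (x₀ ⊕ x₁)) (x₀ ⊕ x₁) refl))))))

  InFamily⇒InB₀ : ∀ {X} → InFamily X → InB₀ G h₀ X
  InFamily⇒InB₀ (inj₁ ((c , a) , (¬Ωa , _) , X≡)) =
    trans (cong ∣_∣ X≡) (∣set4∣≡4 (¬Ω₁⇒distinct ¬Ωa)) , inj₁ (a , ¬Ωa , c , inj₁ X≡)
  InFamily⇒InB₀ (inj₂ (inj₁ ((c , a) , 2a≡h₀ , X≡))) =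
    trans (cong ∣_∣ X≡) (∣set4∣≡4 (¬Ω₁⇒distinct ¬Ωa)) , inj₁ (a , ¬Ωa , c , inj₁ X≡)
    where ¬Ωa = cyclicQ₁⇒¬Ω₁ 2a≡h₀
  InFamily⇒InB₀ (inj₂ (inj₂ (inj₁ ((c , h , a) , ha@(¬Ωa , Ωh , h≢0 , h≢h₀ , 2a≢h) , X≡)))) =
    trans (cong ∣_∣ X≡) (∣set4∣≡4 (paramQ₂⇒distinct ha)) , inj₂ (inj₁ (a , h , ¬Ωa , Ωh , h≢0 , h≢h₀ , 2a≢h , c , inj₁ X≡))
  InFamily⇒InB₀ (inj₂ (inj₂ (inj₂ ((c , h , k) , hk@(Ωh , Ωk , h≢0 , k≢0 , h≢k) , X≡)))) =
    trans (cong ∣_∣ X≡) (∣set4∣≡4 (kleinPair⇒distinct hk)) , inj₂ (inj₂ (h , k , Ωh , Ωk , h≢0 , k≢0 , h≢k , c , inj₁ X≡))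

  inB₀? : ∀ X → Dec (InB₀ G h₀ X)
  inB₀? X = map′ InFamily⇒InB₀ InB₀⇒InFamily (inFamily? X)

  -- A Q₁ shape has h₀ as its only nonzero involutive offset from c; a Q₂ shape is
  -- invariant under h and a Q₃ shape under h and k.
  Q₁∩Q₂≡∅ : ∀ {X c a} → ¬ Ω₁ G a → X ≡ shape₁ c a → ¬ Q₂Set X
  Q₁∩Q₂≡∅ {c = c} {a} ¬Ωa X≡ ((c₂ , h , b) , hb@(_ , Ωh , h≢0 , h≢h₀ , _) , X≡₂) =
    h≢h₀ (Q₁Coset.Ω₁-offset≡h₀ {c} {a} ¬Ωa (subst (_ ∈_) X₂≡X₁ (Q₂Coset.h+-∈ {c₂} hb c∈)) Ωh h≢0)
    where
    X₂≡X₁ = trans (sym X≡₂) X≡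
    c∈ = subst (_ ∈_) (sym X₂≡X₁) set4∋₁

  Q₁∩Q₃≡∅ : ∀ {X c a} → ¬ Ω₁ G a → X ≡ shape₁ c a → ¬ Q₃Set X
  Q₁∩Q₃≡∅ {c = c} {a} ¬Ωa X≡ ((c₃ , h , k) , hk@(Ωh , Ωk , h≢0 , k≢0 , h≢k) , X≡₃) =
    h≢k (trans (offset≡h₀ Ωh h≢0 (inj₂ (inj₁ refl))) (sym (offset≡h₀ Ωk k≢0 (inj₂ (inj₂ (inj₁ refl))))))
    where
    X₃≡X₁ = trans (sym X≡₃) X≡
    c∈ = subst (_ ∈_) (sym X₃≡X₁) set4∋₁
    offset≡h₀ : ∀ {w} → Ω₁ G w → w ≢ 0# → KleinCoset.Pattern {c₃} hk w → w ≡ h₀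
    offset≡h₀ Ωw w≢0 Pw = Q₁Coset.Ω₁-offset≡h₀ {c} {a} ¬Ωa (subst (_ ∈_) X₃≡X₁ (KleinCoset.translate-∈ {c₃} hk c∈ Pw)) Ωw w≢0

  Q₂∩Q₃≡∅ : ∀ {X} → Q₂Set X → ¬ Q₃Set X
  Q₂∩Q₃≡∅ ((c , h , a) , ha , X≡) ((c₃ , p , q) , (Ωp , Ωq , p≢0 , q≢0 , p≢q) , X≡₃) =
    p≢q (trans (Q₂Coset.Ω₁-offset≡h {c} ha c₃∈ (subst (_ ∈_) X₃≡X₂ set4∋₂) Ωp p≢0)
               (sym (Q₂Coset.Ω₁-offset≡h {c} ha c₃∈ (subst (_ ∈_) X₃≡X₂ set4∋₃) Ωq q≢0)))
    where
    X₃≡X₂ = trans (sym X≡₃) X≡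
    c₃∈ = subst (_ ∈_) X₃≡X₂ set4∋₁

  Generic∩Cyclic≡∅ : ∀ {X} → GenericQ₁Set X → ¬ CyclicQ₁Set X
  Generic∩Cyclic≡∅ ((c , a) , (¬Ωa , 2a≢h₀) , X≡) ((c′ , a′) , 2a′≡h₀ , X≡′) =
    2a≢h₀ (proj₁ (CyclicQ₁Coset.choice⇒representation {c′} 2a′≡h₀
                    (subst (_ ∈_) X≡X′ set4∋₁ , ((subst (_ ∈_) X≡X′ set4∋₂ , ¬Ω₁⇒≢0# ¬Ωa) , ¬Ω₁⇒≢ ¬Ωa Ωh₀))))
    where X≡X′ = trans (sym X≡) X≡′

  𝟙-inB₀ : ∀ X → 𝟙 (inB₀? X) ≡ 𝟙 (genericQ₁Set? X) ℕ.+ (𝟙 (cyclicQ₁Set? X) ℕ.+ (𝟙 (q₂Set? X) ℕ.+ 𝟙 (q₃Set? X)))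
  𝟙-inB₀ X = begin
    𝟙 (inB₀? X)         ≡⟨ 𝟙-cong (inB₀? X) (inFamily? X) InB₀⇒InFamily InFamily⇒InB₀ ⟩
    𝟙 (inFamily? X)     ≡⟨ 𝟙-⊎ (genericQ₁Set? X) _ generic∩rest≡∅ ⟩
    _                   ≡⟨ cong (𝟙 (genericQ₁Set? X) ℕ.+_) (𝟙-⊎ (cyclicQ₁Set? X) _ cyclic∩rest≡∅) ⟩
    _                   ≡⟨ cong (λ t → 𝟙 (genericQ₁Set? X) ℕ.+ (𝟙 (cyclicQ₁Set? X) ℕ.+ t)) (𝟙-⊎ (q₂Set? X) (q₃Set? X) (λ (q₂ , q₃) → Q₂∩Q₃≡∅ q₂ q₃)) ⟩
    _                   ∎
    where
    open ≡-Reasoning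
    generic∩rest≡∅ : ¬ (GenericQ₁Set X × (CyclicQ₁Set X ⊎ Q₂Set X ⊎ Q₃Set X))
    generic∩rest≡∅ (g , inj₁ cy)                                     = Generic∩Cyclic≡∅ g cy
    generic∩rest≡∅ ((_ , (¬Ωa , _) , X≡) , inj₂ (inj₁ q₂))          = Q₁∩Q₂≡∅ ¬Ωa X≡ q₂
    generic∩rest≡∅ ((_ , (¬Ωa , _) , X≡) , inj₂ (inj₂ q₃))          = Q₁∩Q₃≡∅ ¬Ωa X≡ q₃
    cyclic∩rest≡∅ : ¬ (CyclicQ₁Set X × (Q₂Set X ⊎ Q₃Set X))
    cyclic∩rest≡∅ ((_ , 2a≡h₀ , X≡) , inj₁ q₂) = Q₁∩Q₂≡∅ (cyclicQ₁⇒¬Ω₁ 2a≡h₀) X≡ q₂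
    cyclic∩rest≡∅ ((_ , 2a≡h₀ , X≡) , inj₂ q₃) = Q₁∩Q₃≡∅ (cyclicQ₁⇒¬Ω₁ 2a≡h₀) X≡ q₃

  #_ : ∀ {P : Subset v → Set} → (∀ X → Dec (P X)) → ℕ
  # P? = ∑ˡ (subsets v) (λ X → 𝟙 (P? X))

  B₀ : List (Subset v)
  B₀ = filter inB₀? (subsets v)

  B₀-enumerates : EnumeratesB₀ G h₀ B₀
  B₀-enumerates = Unique.filter⁺ inB₀? (subsets-unique v) ,
                  λ X → mk⇔ (proj₂ ∘ ∈-filter⁻ inB₀? {xs = subsets v}) (∈-filter⁺ inB₀? (∈-subsets X))

  length-B₀ : length B₀ ≡ # genericQ₁Set? ℕ.+ (# cyclicQ₁Set? ℕ.+ (# q₂Set? ℕ.+ # q₃Set?))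
  length-B₀ = begin
    length B₀                       ≡⟨ length-filter inB₀? (subsets v) ⟩
    # inB₀?                         ≡⟨ ∑ˡ-cong (subsets v) 𝟙-inB₀ ⟩
    _                               ≡⟨ ∑ˡ-distrib-+ (subsets v) (𝟙 ∘ genericQ₁Set?) _ ⟩
    _                               ≡⟨ cong (# genericQ₁Set? ℕ.+_) (∑ˡ-distrib-+ (subsets v) (𝟙 ∘ cyclicQ₁Set?) _) ⟩
    _                               ≡⟨ cong (λ t → # genericQ₁Set? ℕ.+ (# cyclicQ₁Set? ℕ.+ t)) (∑ˡ-distrib-+ (subsets v) (𝟙 ∘ q₂Set?) _) ⟩
    _                               ∎
    where open ≡-Reasoning

  open ParameterCounts G h₀≢0 Ωh₀

  #genericQ₁Set : # genericQ₁Set? ℕ.* 4 ≡ v ℕ.* count genericQ₁?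
  #genericQ₁Set = trans (sym (Pairs.double-count (genericQ₁? ∘ proj₂) (uncurry shape₁) 4
                                (λ (c , a) ga → GenericQ₁Coset.fibre-size {c} {a} ga)))
                        (∑-const v _)

  #cyclicQ₁Set : # cyclicQ₁Set? ℕ.* 8 ≡ v ℕ.* halves h₀
  #cyclicQ₁Set = trans (sym (Pairs.double-count (cyclicQ₁? ∘ proj₂) (uncurry shape₁) 8
                               (λ (c , a) 2a≡h₀ → CyclicQ₁Coset.fibre-size {c} {a} 2a≡h₀)))
                       (∑-const v _)

  #q₂Set : # q₂Set? ℕ.* 8 ≡ v ℕ.* ∑[ h < v ] ∑[ a < v ] 𝟙 (paramQ₂? h a)
  #q₂Set = trans (sym (Triples.double-count (uncurry paramQ₂? ∘ proj₂) shape₂′ 8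
                         (λ (c , h , a) ha → Q₂Coset.fibre-size {c} {h} {a} ha)))
                 (∑-const v _)

  #q₃Set : # q₃Set? ℕ.* 24 ≡ v ℕ.* (count nonzeroΩ₁? ℕ.* count (other? h₀))
  #q₃Set = trans (sym (Triples.double-count (uncurry kleinPair? ∘ proj₂) shape₃′ 24
                         (λ (c , h , k) hk → KleinCoset.fibre-size {c} {h} {k} hk)))
                 (trans (∑-const v _) (cong (v ℕ.*_) ∑∑-kleinPair))

  #B₀ : + 24 * + length B₀ ≡ + 3 * + v * + v * + ω₁ G - + v * (+ 2 * + ω₁ G * + ω₁ G +ℤ + 3 * + ω₂ G - + 2)
  #B₀ = begin
    + 24 * + length B₀
      ≡⟨ cong (λ n → + 24 * + n) length-B₀ ⟩
    + 24 * + (# genericQ₁Set? ℕ.+ (# cyclicQ₁Set? ℕ.+ (# q₂Set? ℕ.+ # q₃Set?)))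
      ≡⟨ counting-identity (# genericQ₁Set?) (# cyclicQ₁Set?) (# q₂Set?) (# q₃Set?) v (count genericQ₁?) (halves h₀) T nH S nI w₁ w₂
           (count-genericFor h₀ h₀≢0) ∑∑-paramQ₂ (count-other (Ωh₀ , h₀≢0)) count-nonzeroΩ₁ ∑-other*halves
           #genericQ₁Set #cyclicQ₁Set #q₂Set #q₃Set ⟩
    + 3 * + v * + v * + w₁ - + v * (+ 2 * + w₁ * + w₁ +ℤ + 3 * + w₂ - + 2)
      ≡⟨ cong₂ (λ x y → + 3 * + v * + v * + x - + v * (+ 2 * + x * + x +ℤ + 3 * + y - + 2)) (sym ω₁≡halves0) (sym ω₂≡count) ⟩
    + 3 * + v * + v * + ω₁ G - + v * (+ 2 * + ω₁ G * + ω₁ G +ℤ + 3 * + ω₂ G - + 2)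
      ∎
    where
    open ≡-Reasoning
    T  = ∑[ h < v ] ∑[ a < v ] 𝟙 (paramQ₂? h a)
    nH = count (other? h₀)
    S  = ∑[ h < v ] (𝟙 (other? h₀ h) ℕ.* halves h)
    nI = count nonzeroΩ₁?
    w₁ = halves 0#
    w₂ = count (λ a → a + a + a + a ≟ 0#)

open import Data.Integer.Base using (+_; _-_; _*_) renaming (_+_ to _+ℤ_)
open import Data.List.Base using (length)
open import Data.Nat.Base using (_%_)
open import Data.Product.Base using (∃-syntax)

lemma4p9 : (v : ℕ) → (G : FinAbGroup v) → (v % 6 ≡ 2 ⊎ v % 6 ≡ 4)
    → (h₀ : Fin v) → h₀ ≢ FinAbGroup.0# G → FinAbGroup._+_ G h₀ h₀ ≡ FinAbGroup.0# G
    → ∃[ L ] (EnumeratesB₀ G h₀ L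
    × (+ 24) * (+ length L)
    ≡ (+ 3) * (+ v) * (+ v) * (+ ω₁ G)
    - (+ v) * ((+ 2) * (+ ω₁ G) * (+ ω₁ G) +ℤ (+ 3) * (+ ω₂ G) - (+ 2)))
lemma4p9 v G _ h₀ h₀≢0 Ωh₀ = B₀ , B₀-enumerates , #B₀
  where open B₀Decomposition G h₀≢0 Ωh₀
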